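{- Let $G$ be a finite graph with vertex set $V$ and weight function $\omega:V\to\mathbb{Z}_{>0}$. For every partition $\lambda$, the coefficient $[\overline{p}_\lambda]\overline{X}_{(G,\omega)}$ of $\overline{p}_\lambda$ in the expansion of $\overline{X}_{(G,\omega)}$ in the $\overline{p}$-basis is an integer.
   Context: A proper set coloring of $(G,\omega)$ assigns to each vertex a nonempty subset of $\mathbb{Z}_{>0}$ such that adjacent vertices receive disjoint sets; the Kromatic symmetric function is $\overline{X}_{(G,\omega)}=\sum_\alpha\prod_{v\in V}\prod_{i\in\alpha(v)}x_i^{\omega(v)}$ over all proper set colorings $\alpha$. For a partition $\lambda$, $\overline{p}_\lambda:=\overline{X}_{\overline{K_\lambda}}$, where $\overline{K_\lambda}$ is the edgeless graph whose vertex weights are the parts of $\lambda$. $\overline{X}_{(G,\omega)}$ has a unique (possibly infinite) expansion $\sum_\lambda c_\lambda\overline{p}_\lambda$, and $[\overline{p}_\lambda]\overline{X}_{(G,\omega)}=c_\lambda$. -}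

module Defs where

open import Data.Bool using (Bool; true; false; _∧_; _∨_; not; if_then_else_)
open import Data.Nat using (ℕ; zero; suc; _+_; _≤_; _<_; _≥_; _≡ᵇ_)
open import Data.Fin using (Fin)
open import Data.Nat.ListAction using (sum)
open import Data.List using (List; []; _∷_; length; map; concat; concatMap; foldr; upTo; allFin; filter; applyUpTo; lookup)
open import Data.Vec using (Vec; []; _∷_)
open import Data.Vec.Functional as VF using ()
open import Data.Integer using (ℤ; +_)
open import Data.Rational using (ℚ; _/_)
import Data.Rational as ℚ
open import Data.List.Relation.Unary.All using (All)
open import Relation.Binary.PropositionalEquality using (_≡_)
open import Data.Product using (Σ; ∃-syntax; _×_)

record Graph (n : ℕ) : Set where
  field
    adj    : Fin n → Fin n → Bool
    sym    : ∀ u v → adj u v ≡ adj v u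
    irrefl : ∀ v → adj v v ≡ false

open Graph public

edgeless : (n : ℕ) → Graph n
edgeless n = record { adj = λ _ _ → false ; sym = λ _ _ → _≡_.refl ; irrefl = λ _ → _≡_.refl }

-- Monomials in x_1, x_2, ... : a finite list of exponents (a_1,...,a_k)
-- stands for x_1^{a_1} ... x_k^{a_k} (trailing zeros are harmless).

Monomial : Set
Monomial = List ℕ

degree : Monomial → ℕ
degree = sum

ColourSet : ℕ → Set
ColourSet k = Fin k → Bool

allSubsets : (k : ℕ) → List (Vec Bool k)
allSubsets zero    = [] ∷ []
allSubsets (suc k) = concatMap (λ s → (true ∷ s) ∷ (false ∷ s) ∷ []) (allSubsets k)

allAssignments : (n k : ℕ) → List (Vec (Vec Bool k) n)
allAssignments zero    k = [] ∷ []
allAssignments (suc n) k =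
  concatMap (λ rest → map (λ s → s ∷ rest) (allSubsets k)) (allAssignments n k)

anyFin : ∀ {m} → (Fin m → Bool) → Bool
anyFin {m} p = foldr _∨_ false (map p (allFin m))

allFinB : ∀ {m} → (Fin m → Bool) → Bool
allFinB {m} p = foldr _∧_ true (map p (allFin m))

sumFin : ∀ {m} → (Fin m → ℕ) → ℕ
sumFin {m} f = sum (map f (allFin m))

goodColouring : ∀ {n} (G : Graph n) (ω : Fin n → ℕ) (a : Monomial)
              → Vec (Vec Bool (length a)) n → Bool
goodColouring {n} G ω a α =
  allFinB (λ v → anyFin (λ i → Data.Vec.lookup (Data.Vec.lookup α v) i))
  ∧ allFinB (λ u → allFinB (λ v →
        not (adj G u v) ∨
        not (anyFin (λ i → Data.Vec.lookup (Data.Vec.lookup α u) i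
                         ∧ Data.Vec.lookup (Data.Vec.lookup α v) i))))
  ∧ allFinB (λ i →
        sumFin (λ v → if Data.Vec.lookup (Data.Vec.lookup α v) i then ω v else 0)
          ≡ᵇ lookup a i)

-- [x^a] X̄_(G,ω) : the number of proper set colourings with monomial x^a.
-- (Colours i > length a cannot occur, since every weight is positive.)
kromaticCoeff : ∀ {n} (G : Graph n) (ω : Fin n → ℕ) (a : Monomial) → ℕ
kromaticCoeff G ω a = length (filter (λ α → goodColouring G ω a α Data.Bool.≟ true)
                                     (allAssignments _ (length a)))
  where import Data.Bool

data Decreasing : List ℕ → Set where
  []  : Decreasing []
  [_] : ∀ x → Decreasing (x ∷ [])
  _∷_ : ∀ {x y l} → y ≤ x → Decreasing (y ∷ l) → Decreasing (x ∷ y ∷ l)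

IsPartition : List ℕ → Set
IsPartition l = Decreasing l × All (λ x → 0 < x) l

partsBounded : (fuel s m : ℕ) → List (List ℕ)
partsBounded _        zero    m = [] ∷ []
partsBounded zero     (suc s) m = []
partsBounded (suc f)  (suc s) m =
  concatMap (λ j → let k = suc j in
               if Data.Nat._≤ᵇ_ k m
               then map (k ∷_) (partsBounded f (suc s Data.Nat.∸ k) k)
               else [])
            (upTo (suc s))

partitionsOf : ℕ → List (List ℕ)
partitionsOf s = partsBounded s s s

partitionsUpTo : ℕ → List (List ℕ)
partitionsUpTo d = concatMap partitionsOf (upTo (suc d))

pbarCoeff : (λ' : List ℕ) (a : Monomial) → ℕ
pbarCoeff λ' a = kromaticCoeff (edgeless (length λ')) (lookup λ') a

ℕ→ℚ : ℕ → ℚ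
ℕ→ℚ n = (+ n) / 1

sumℚ : List ℚ → ℚ
sumℚ = foldr ℚ._+_ ℚ.0ℚ

-- Since [x^a] p̄_λ = 0 whenever |λ| > deg a,
-- only the partitions with |λ| ≤ deg a contribute to the coefficient of x^a.
IsPbarExpansion : ∀ {n} (G : Graph n) (ω : Fin n → ℕ) (c : List ℕ → ℚ) → Set
IsPbarExpansion G ω c =
  ∀ (a : Monomial) →
    sumℚ (map (λ λ' → c λ' ℚ.* ℕ→ℚ (pbarCoeff λ' a)) (partitionsUpTo (degree a)))
      ≡ ℕ→ℚ (kromaticCoeff G ω a)

IsInteger : ℚ → Set
IsInteger q = ∃[ z ] q ≡ z / 1

-- Inclusion–exclusion over the set U of vertices that receive no colour writes
-- X̄_(G,ω) = Σ_U (−1)^|U| ∏_i H_U(x_i), where H_U(t) = Σ_S t^ω(S) runs over the independent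
-- sets S disjoint from U; positivity of ω gives H_U(0) = 1. For the edgeless graph the same
-- formula yields p̄_k = ∏_i (1 + x_i^k) − 1 and p̄_λ = ∏_j p̄_λⱼ. Up to any fixed degree, an
-- integer series H with H(0) = 1 factors as ∏_k (1 + t^k)^(e_k) with e_k ∈ ℤ, so
-- ∏_i H(x_i) = ∏_k (1 + p̄_k)^(e_k) is an integer combination of the p̄_λ. Conversely the
-- coefficient of x^λ in p̄_μ vanishes when |μ| > |λ|, or |μ| = |λ|, ℓ(μ) ≤ ℓ(λ) and μ ≠ λ,
-- and is positive for μ = λ; by induction on (|λ|, |λ| − ℓ(λ)) the coefficients of any
-- expansion are determined, hence equal to the integer ones.

module Submission where

open import Data.Bool using (Bool; true; false; not; _∧_; _∨_; if_then_else_; T) renaming (_≟_ to _≟ᵇ_)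
open import Data.Bool.Properties using (∨-zeroʳ)
open import Data.Empty using (⊥-elim)
open import Data.Fin using (Fin; zero; suc)
open import Data.Integer as ℤ using (ℤ; +_; -[1+_]; -_; _+_; _*_; _-_; 0ℤ; 1ℤ; -1ℤ; +≤+)
open import Data.Integer.Properties
open import Data.Integer.Tactic.RingSolver using (solve-∀)
open import Data.List as List using (List; []; _∷_; _++_; _∷ʳ_; map; concatMap; length; filter; foldr; tabulate; applyUpTo)
open import Data.List.Properties
  using (map-cong; map-tabulate; ≡-dec; filter-++; length-++; filter-none; filter-accept; filter-reject; ∷-injectiveˡ; ∷-injectiveʳ)
open import Data.List.Relation.Binary.Permutation.Propositional as ↭ using (_↭_)
open import Data.List.Relation.Binary.Permutation.Propositional.Properties using (∷↭∷ʳ)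
open import Data.List.Relation.Unary.All as All using (All; []; _∷_)
open import Data.List.Relation.Unary.All.Properties using (++⁺; map⁺)
open import Data.Nat as ℕ using (ℕ; zero; suc; _≡ᵇ_; _≤ᵇ_; _∸_; _≤_; _<_; z≤n; s≤s)
open import Data.Nat.Induction using (<-rec; <-wellFounded)
open import Data.Nat.ListAction using () renaming (sum to sumℕ)
import Data.Nat.Properties as ℕ
open import Data.Product using (∃-syntax; _×_; _,_; proj₁; proj₂)
open import Data.Product.Relation.Binary.Lex.Strict using (×-Lex; ×-wellFounded)
open import Data.Rational as ℚ using (ℚ; _/_; 0ℚ; 1ℚ; toℚᵘ)
import Data.Rational.Properties as ℚ
open import Data.Rational.Solver using () renaming (module +-*-Solver to ℚ-Solver)
open import Data.Rational.Unnormalised as ℚᵘ using (mkℚᵘ)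
import Data.Rational.Unnormalised.Properties as ℚᵘ
open import Data.Sum using (_⊎_; inj₁; inj₂)
open import Data.Unit using (tt)
open import Data.Vec as Vec using (Vec; []; _∷_; zipWith)
open import Data.Vec.Properties using (lookup-zipWith; lookup-replicate) renaming (∷-injectiveʳ to Vec-∷-injectiveʳ)
open import Function using (_∘_; _on_; id)
import Induction.WellFounded as WF
open WF using (WellFounded)
import Relation.Binary.Construct.On as On
open import Relation.Binary.Definitions using (DecidableEquality; tri<; tri≈; tri>)
open import Relation.Binary.PropositionalEquality
open ≡-Reasoning
open import Relation.Nullary using (Dec; yes; no; does)
open import Defs hiding (sym)

open import Algebra.Properties.CommutativeMonoid.Sum *-1-commutativeMonoid
  using () renaming (sum to ∏; sum-cong-≗ to ∏-cong; ∑-distrib-+ to ∏-distrib-*; ∑-comm to ∏-comm; sum-replicate-zero to ∏-one)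
open import Algebra.Properties.CommutativeSemigroup +-commutativeSemigroup
  using () renaming (interchange to +-interchange)
open import Algebra.Properties.CommutativeSemigroup *-commutativeSemigroup
  using () renaming (x∙yz≈y∙xz to *-swapˡ; x∙yz≈z∙xy to *-rotate)
open import Algebra.Properties.CommutativeSemigroup ℕ.+-commutativeSemigroup
  using () renaming (interchange to ℕ-+-interchange; x∙yz≈y∙xz to ℕ-+-swapˡ)

private variable A B : Set

∑ : (A → ℤ) → List A → ℤ
∑ f []       = 0ℤ
∑ f (x ∷ xs) = f x + ∑ f xs

∑-cong : {f g : A → ℤ} → f ≗ g → ∀ xs → ∑ f xs ≡ ∑ g xs
∑-cong f≗g []       = refl
∑-cong f≗g (x ∷ xs) = cong₂ _+_ (f≗g x) (∑-cong f≗g xs)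

∑-cong-All : ∀ {P : A → Set} {f g : A → ℤ} {xs} → All P xs → (∀ {x} → P x → f x ≡ g x) → ∑ f xs ≡ ∑ g xs
∑-cong-All []         f≡g = refl
∑-cong-All (px ∷ pxs) f≡g = cong₂ _+_ (f≡g px) (∑-cong-All pxs f≡g)

∑-zero : (xs : List A) → ∑ (λ _ → 0ℤ) xs ≡ 0ℤ
∑-zero []       = refl
∑-zero (x ∷ xs) = trans (+-identityˡ _) (∑-zero xs)

∑-distrib-+ : (f g : A → ℤ) → ∀ xs → ∑ (λ x → f x + g x) xs ≡ ∑ f xs + ∑ g xs
∑-distrib-+ f g []       = refl
∑-distrib-+ f g (x ∷ xs) rewrite ∑-distrib-+ f g xs = +-interchange (f x) (g x) (∑ f xs) (∑ g xs)

∑-*ˡ : ∀ c (f : A → ℤ) xs → ∑ (λ x → c * f x) xs ≡ c * ∑ f xs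
∑-*ˡ c f []       = sym (*-zeroʳ c)
∑-*ˡ c f (x ∷ xs) rewrite ∑-*ˡ c f xs = sym (*-distribˡ-+ c (f x) (∑ f xs))

∑-*ʳ : ∀ c (f : A → ℤ) xs → ∑ (λ x → f x * c) xs ≡ ∑ f xs * c
∑-*ʳ c f xs = trans (∑-cong (λ x → *-comm (f x) c) xs) (trans (∑-*ˡ c f xs) (*-comm c _))

∑-++ : (f : A → ℤ) → ∀ xs ys → ∑ f (xs ++ ys) ≡ ∑ f xs + ∑ f ys
∑-++ f []       ys = sym (+-identityˡ _)
∑-++ f (x ∷ xs) ys rewrite ∑-++ f xs ys = sym (+-assoc (f x) _ _)

∑-concatMap : (f : B → ℤ) (g : A → List B) → ∀ xs → ∑ f (concatMap g xs) ≡ ∑ (∑ f ∘ g) xs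
∑-concatMap f g []       = refl
∑-concatMap f g (x ∷ xs) = trans (∑-++ f (g x) (concatMap g xs)) (cong (_+_ (∑ f (g x))) (∑-concatMap f g xs))

∑-comm : (f : A → B → ℤ) → ∀ xs ys → ∑ (λ x → ∑ (f x) ys) xs ≡ ∑ (λ y → ∑ (λ x → f x y) xs) ys
∑-comm f []       ys = sym (∑-zero ys)
∑-comm f (x ∷ xs) ys = trans (cong (_+_ (∑ (f x) ys)) (∑-comm f xs ys)) (sym (∑-distrib-+ (f x) _ ys))

∑-map : (f : B → ℤ) (g : A → B) → ∀ xs → ∑ f (map g xs) ≡ ∑ (f ∘ g) xs
∑-map f g []       = refl
∑-map f g (x ∷ xs) = cong (_+_ (f (g x))) (∑-map f g xs)

𝟙 : Bool → ℤ
𝟙 true  = 1ℤ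
𝟙 false = 0ℤ

𝟙-∧ : ∀ x y → 𝟙 (x ∧ y) ≡ 𝟙 x * 𝟙 y
𝟙-∧ true  y = sym (*-identityˡ _)
𝟙-∧ false y = refl

𝟙-not-∨ : ∀ x y → 𝟙 (not (x ∨ y)) ≡ 𝟙 (not x) * 𝟙 (not y)
𝟙-not-∨ true  y = refl
𝟙-not-∨ false y = sym (*-identityˡ _)

𝟙≡1-𝟙-not : ∀ b → 𝟙 b ≡ 1ℤ - 𝟙 (not b)
𝟙≡1-𝟙-not true  = refl
𝟙≡1-𝟙-not false = refl

𝟙-all-tabulate : ∀ m (g : Fin m → A) (p : A → Bool) → 𝟙 (foldr _∧_ true (map p (tabulate g))) ≡ ∏ (λ i → 𝟙 (p (g i)))
𝟙-all-tabulate zero    g p = refl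
𝟙-all-tabulate (suc m) g p = trans (𝟙-∧ (p (g zero)) _) (cong (_*_ (𝟙 (p (g zero)))) (𝟙-all-tabulate m (g ∘ suc) p))

𝟙-allFinB : ∀ {m} (p : Fin m → Bool) → 𝟙 (allFinB p) ≡ ∏ (𝟙 ∘ p)
𝟙-allFinB {m} = 𝟙-all-tabulate m id

𝟙-none-tabulate : ∀ m (g : Fin m → A) (p : A → Bool) →
  𝟙 (not (foldr _∨_ false (map p (tabulate g)))) ≡ ∏ (λ i → 𝟙 (not (p (g i))))
𝟙-none-tabulate zero    g p = refl
𝟙-none-tabulate (suc m) g p = trans (𝟙-not-∨ (p (g zero)) _) (cong (_*_ (𝟙 (not (p (g zero))))) (𝟙-none-tabulate m (g ∘ suc) p))

𝟙-not-anyFin : ∀ {m} (p : Fin m → Bool) → 𝟙 (not (anyFin p)) ≡ ∏ (λ i → 𝟙 (not (p i)))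
𝟙-not-anyFin {m} = 𝟙-none-tabulate m id

𝟙-anyFin : ∀ {m} (p : Fin m → Bool) → 𝟙 (anyFin p) ≡ 1ℤ - ∏ (λ i → 𝟙 (not (p i)))
𝟙-anyFin p = trans (𝟙≡1-𝟙-not (anyFin p)) (cong (_-_ 1ℤ) (𝟙-not-anyFin p))

if-∏ : ∀ {k} (b : Bool) (g : Fin k → ℤ) → (if b then ∏ g else 1ℤ) ≡ ∏ (λ i → if b then g i else 1ℤ)
if-∏     true  g = refl
if-∏ {k} false g = sym (∏-one k)

𝟙-not-∨-anyFin : ∀ {k} (b : Bool) (q : Fin k → Bool) → 𝟙 (not b ∨ not (anyFin q)) ≡ ∏ (λ i → 𝟙 (not b ∨ not (q i)))
𝟙-not-∨-anyFin {k} false q = sym (∏-one k)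
𝟙-not-∨-anyFin     true  q = 𝟙-not-anyFin q

length-filter≡∑𝟙 : (P : A → Bool) → ∀ xs → + length (filter (λ x → P x ≟ᵇ true) xs) ≡ ∑ (𝟙 ∘ P) xs
length-filter≡∑𝟙 P []       = refl
length-filter≡∑𝟙 P (x ∷ xs) with P x
... | true  = cong (_+_ 1ℤ) (length-filter≡∑𝟙 P xs)
... | false = trans (length-filter≡∑𝟙 P xs) (sym (+-identityˡ _))

-- Inclusion–exclusion for the coefficients of X̄

∑-allSubsets-suc : ∀ n (F : Vec Bool (suc n) → ℤ) →
  ∑ F (allSubsets (suc n)) ≡ ∑ (λ S → F (true ∷ S) + F (false ∷ S)) (allSubsets n)
∑-allSubsets-suc n F = trans (∑-concatMap F _ (allSubsets n))
  (∑-cong (λ S → cong (_+_ (F (true ∷ S))) (+-identityʳ _)) (allSubsets n))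

sign : ∀ {n} → Vec Bool n → ℤ
sign U = ∏ (λ v → if Vec.lookup U v then -1ℤ else 1ℤ)

inclusion-exclusion : ∀ n (x : Fin n → ℤ) →
  ∏ (λ v → 1ℤ - x v) ≡ ∑ (λ U → sign U * ∏ (λ v → if Vec.lookup U v then x v else 1ℤ)) (allSubsets n)
inclusion-exclusion zero    x = refl
inclusion-exclusion (suc n) x = sym (begin
  ∑ F (allSubsets (suc n))                                  ≡⟨ ∑-allSubsets-suc n F ⟩
  ∑ (λ S → F (true ∷ S) + F (false ∷ S)) (allSubsets n)     ≡⟨ ∑-cong (λ S → split (x zero) (sign S) (P S)) (allSubsets n) ⟩
  ∑ (λ S → (1ℤ - x zero) * (sign S * P S)) (allSubsets n)   ≡⟨ ∑-*ˡ (1ℤ - x zero) _ (allSubsets n) ⟩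
  (1ℤ - x zero) * ∑ (λ S → sign S * P S) (allSubsets n)     ≡⟨ cong (_*_ (1ℤ - x zero)) (sym (inclusion-exclusion n (x ∘ suc))) ⟩
  (1ℤ - x zero) * ∏ (λ v → 1ℤ - x (suc v))                  ∎)
  where
  F : Vec Bool (suc n) → ℤ
  F U = sign U * ∏ (λ v → if Vec.lookup U v then x v else 1ℤ)
  P : Vec Bool n → ℤ
  P S = ∏ (λ v → if Vec.lookup S v then x (suc v) else 1ℤ)
  split : ∀ a s p → -1ℤ * s * (a * p) + 1ℤ * s * (1ℤ * p) ≡ (1ℤ - a) * (s * p)
  split = solve-∀

∑-allAssignments-vertex : ∀ n k (F : Vec (Vec Bool k) (suc n) → ℤ) →
  ∑ F (allAssignments (suc n) k) ≡ ∑ (λ β → ∑ (λ s → F (s ∷ β)) (allSubsets k)) (allAssignments n k)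
∑-allAssignments-vertex n k F = trans (∑-concatMap F _ (allAssignments n k))
  (∑-cong (λ β → ∑-map F (_∷ β) (allSubsets k)) (allAssignments n k))

∑-allAssignments-colour : ∀ n k (F : Vec (Vec Bool (suc k)) n → ℤ) →
  ∑ F (allAssignments n (suc k)) ≡ ∑ (λ c → ∑ (λ β → F (zipWith _∷_ c β)) (allAssignments n k)) (allSubsets n)
∑-allAssignments-colour zero    k F = sym (+-identityʳ (F [] + 0ℤ))
∑-allAssignments-colour (suc n) k F = begin
  ∑ F (allAssignments (suc n) (suc k))
    ≡⟨ ∑-allAssignments-vertex n (suc k) F ⟩
  ∑ (λ β → ∑ (λ s → F (s ∷ β)) (allSubsets (suc k))) (allAssignments n (suc k))
    ≡⟨ ∑-cong (λ β → ∑-allSubsets-suc k (λ s → F (s ∷ β))) (allAssignments n (suc k)) ⟩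
  ∑ G (allAssignments n (suc k))
    ≡⟨ ∑-allAssignments-colour n k G ⟩
  ∑ (λ c → ∑ (λ β → G (zipWith _∷_ c β)) (allAssignments n k)) (allSubsets n)
    ≡⟨ ∑-cong (λ c → trans (∑-cong (λ β → ∑-distrib-+ _ _ (allSubsets k)) (allAssignments n k))
                           (∑-distrib-+ (H′ true c) (H′ false c) (allAssignments n k))) (allSubsets n) ⟩
  ∑ (λ c → H true c + H false c) (allSubsets n)
    ≡⟨ ∑-cong (λ c → cong₂ _+_ (∑-allAssignments-vertex n k _) (∑-allAssignments-vertex n k _)) (allSubsets n) ⟨
  ∑ (λ c → K (true ∷ c) + K (false ∷ c)) (allSubsets n)
    ≡⟨ ∑-allSubsets-suc n K ⟨
  ∑ K (allSubsets (suc n)) ∎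
  where
  G : Vec (Vec Bool (suc k)) n → ℤ
  G β = ∑ (λ s → F ((true ∷ s) ∷ β) + F ((false ∷ s) ∷ β)) (allSubsets k)
  H′ : Bool → Vec Bool n → Vec (Vec Bool k) n → ℤ
  H′ b c β = ∑ (λ s → F ((b ∷ s) ∷ zipWith _∷_ c β)) (allSubsets k)
  H : Bool → Vec Bool n → ℤ
  H b c = ∑ (H′ b c) (allAssignments n k)
  K : Vec Bool (suc n) → ℤ
  K c = ∑ (λ β → F (zipWith _∷_ c β)) (allAssignments (suc n) k)

column : ∀ {n k} → Vec (Vec Bool k) n → Fin k → Fin n → Bool
column α i v = Vec.lookup (Vec.lookup α v) i

∑-allAssignments-no-colour : ∀ n → ∑ (λ _ → 1ℤ) (allAssignments n 0) ≡ 1ℤ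
∑-allAssignments-no-colour zero    = refl
∑-allAssignments-no-colour (suc n) = trans (∑-allAssignments-vertex n 0 (λ _ → 1ℤ)) (∑-allAssignments-no-colour n)

∑-∏-columns : ∀ n k (Ψ : Fin k → (Fin n → Bool) → ℤ) → (∀ i {f g} → f ≗ g → Ψ i f ≡ Ψ i g) →
  ∑ (λ α → ∏ (λ i → Ψ i (column α i))) (allAssignments n k) ≡ ∏ (λ i → ∑ (Ψ i ∘ Vec.lookup) (allSubsets n))
∑-∏-columns n zero    Ψ Ψ-cong = ∑-allAssignments-no-colour n
∑-∏-columns n (suc k) Ψ Ψ-cong = begin
  ∑ (λ α → ∏ (λ i → Ψ i (column α i))) (allAssignments n (suc k))
    ≡⟨ ∑-allAssignments-colour n k _ ⟩
  ∑ (λ c → ∑ (λ β → Ψ zero (column (zipWith _∷_ c β) zero)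
                   * ∏ (λ i → Ψ (suc i) (column (zipWith _∷_ c β) (suc i)))) (allAssignments n k)) (allSubsets n)
    ≡⟨ ∑-cong (λ c → ∑-cong (λ β → cong₂ _*_ (Ψ-cong zero (column₀ c β)) (∏-cong (λ i → Ψ-cong (suc i) (column₊ c β i))))
                              (allAssignments n k)) (allSubsets n) ⟩
  ∑ (λ c → ∑ (λ β → Ψ zero (Vec.lookup c) * Rest β) (allAssignments n k)) (allSubsets n)
    ≡⟨ ∑-cong (λ c → ∑-*ˡ (Ψ zero (Vec.lookup c)) Rest (allAssignments n k)) (allSubsets n) ⟩
  ∑ (λ c → Ψ zero (Vec.lookup c) * ∑ Rest (allAssignments n k)) (allSubsets n)
    ≡⟨ ∑-*ʳ _ (Ψ zero ∘ Vec.lookup) (allSubsets n) ⟩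
  ∑ (Ψ zero ∘ Vec.lookup) (allSubsets n) * ∑ Rest (allAssignments n k)
    ≡⟨ cong (_*_ (∑ (Ψ zero ∘ Vec.lookup) (allSubsets n))) (∑-∏-columns n k (Ψ ∘ suc) (Ψ-cong ∘ suc)) ⟩
  ∏ (λ i → ∑ (Ψ i ∘ Vec.lookup) (allSubsets n)) ∎
  where
  Rest : Vec (Vec Bool k) n → ℤ
  Rest β = ∏ (λ i → Ψ (suc i) (column β i))
  column₀ : ∀ c β → column (zipWith _∷_ c β) zero ≗ Vec.lookup c
  column₀ c β v = cong (λ r → Vec.lookup r zero) (lookup-zipWith _∷_ v c β)
  column₊ : ∀ c β i → column (zipWith _∷_ c β) (suc i) ≗ column β i
  column₊ c β i v = cong (λ r → Vec.lookup r (suc i)) (lookup-zipWith _∷_ v c β)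

module _ {n : ℕ} where

  avoids : Vec Bool n → (Fin n → Bool) → ℤ
  avoids U S = ∏ (λ v → if Vec.lookup U v then 𝟙 (not (S v)) else 1ℤ)

  independent : Graph n → (Fin n → Bool) → ℤ
  independent G S = ∏ λ u → ∏ λ v → 𝟙 (not (adj G u v) ∨ not (S u ∧ S v))

  weight : (Fin n → ℕ) → (Fin n → Bool) → ℕ
  weight ω S = sumFin (λ v → if S v then ω v else 0)

  independentOfWeight : Graph n → (Fin n → ℕ) → Vec Bool n → ℕ → (Fin n → Bool) → ℤ
  independentOfWeight G ω U m S = avoids U S * (independent G S * 𝟙 (weight ω S ≡ᵇ m))

  independentCount : Graph n → (Fin n → ℕ) → Vec Bool n → ℕ → ℤ
  independentCount G ω U m = ∑ (independentOfWeight G ω U m ∘ Vec.lookup) (allSubsets n)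

  independentOfWeight-cong : ∀ G ω U m {S S′} → S ≗ S′ → independentOfWeight G ω U m S ≡ independentOfWeight G ω U m S′
  independentOfWeight-cong G ω U m S≗S′ =
    cong₂ _*_ (∏-cong (λ v → cong (λ b → if Vec.lookup U v then 𝟙 (not b) else 1ℤ) (S≗S′ v)))
    (cong₂ _*_ (∏-cong (λ u → ∏-cong (λ v → cong₂ (λ x y → 𝟙 (not (adj G u v) ∨ not (x ∧ y))) (S≗S′ u) (S≗S′ v))))
               (cong (λ s → 𝟙 (s ≡ᵇ m)) (cong sumℕ (map-cong (λ v → cong (λ b → if b then ω v else 0) (S≗S′ v)) (List.allFin n)))))

Series : Set
Series = Monomial → ℤ

-- ∏ᵢ h a is the coefficient of x^a in ∏_i H(x_i), where H(t) = Σ_j h j · t^j.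
∏ᵢ : (ℕ → ℤ) → Series
∏ᵢ h []      = 1ℤ
∏ᵢ h (x ∷ a) = h x * ∏ᵢ h a

∏ᵢ-cong : {h g : ℕ → ℤ} → h ≗ g → ∏ᵢ h ≗ ∏ᵢ g
∏ᵢ-cong h≗g []      = refl
∏ᵢ-cong h≗g (x ∷ a) = cong₂ _*_ (h≗g x) (∏ᵢ-cong h≗g a)

∏-lookup : (h : ℕ → ℤ) → ∀ a → ∏ (λ i → h (List.lookup a i)) ≡ ∏ᵢ h a
∏-lookup h []      = refl
∏-lookup h (x ∷ a) = cong (_*_ (h x)) (∏-lookup h a)

𝟙-nonempty : ∀ {n k} (α : Vec (Vec Bool k) n) →
  𝟙 (allFinB (λ v → anyFin (λ i → column α i v))) ≡ ∑ (λ U → sign U * ∏ (λ i → avoids U (column α i))) (allSubsets n)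
𝟙-nonempty {n} α = begin
  𝟙 (allFinB (λ v → anyFin (λ i → column α i v)))
    ≡⟨ 𝟙-allFinB (λ v → anyFin (λ i → column α i v)) ⟩
  ∏ (λ v → 𝟙 (anyFin (λ i → column α i v)))
    ≡⟨ ∏-cong (λ v → 𝟙-anyFin (λ i → column α i v)) ⟩
  ∏ (λ v → 1ℤ - ∏ (λ i → 𝟙 (not (column α i v))))
    ≡⟨ inclusion-exclusion n (λ v → ∏ (λ i → 𝟙 (not (column α i v)))) ⟩
  ∑ (λ U → sign U * ∏ (λ v → if Vec.lookup U v then ∏ (λ i → 𝟙 (not (column α i v))) else 1ℤ)) (allSubsets n)
    ≡⟨ ∑-cong (λ U → cong (_*_ (sign U)) (trans (∏-cong (λ v → if-∏ (Vec.lookup U v) (λ i → 𝟙 (not (column α i v)))))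
                                         (∏-comm (λ v i → if Vec.lookup U v then 𝟙 (not (column α i v)) else 1ℤ)))) (allSubsets n) ⟩
  ∑ (λ U → sign U * ∏ (λ i → avoids U (column α i))) (allSubsets n) ∎

𝟙-proper : ∀ {n k} (G : Graph n) (α : Vec (Vec Bool k) n) →
  𝟙 (allFinB (λ u → allFinB (λ v → not (adj G u v) ∨ not (anyFin (λ i → column α i u ∧ column α i v)))))
    ≡ ∏ (λ i → independent G (column α i))
𝟙-proper {n} G α = begin
  𝟙 (allFinB (λ u → allFinB (λ v → not (adj G u v) ∨ not (anyFin (λ i → column α i u ∧ column α i v)))))
    ≡⟨ 𝟙-allFinB (λ u → allFinB (disjoint u)) ⟩
  ∏ (λ u → 𝟙 (allFinB (disjoint u)))
    ≡⟨ ∏-cong (λ u → 𝟙-allFinB (disjoint u)) ⟩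
  ∏ (λ u → ∏ (λ v → 𝟙 (not (adj G u v) ∨ not (anyFin (λ i → column α i u ∧ column α i v)))))
    ≡⟨ ∏-cong (λ u → ∏-cong (λ v → 𝟙-not-∨-anyFin (adj G u v) (λ i → column α i u ∧ column α i v))) ⟩
  ∏ (λ u → ∏ (λ v → ∏ (λ i → edge u v i)))
    ≡⟨ ∏-cong (λ u → ∏-comm (edge u)) ⟩
  ∏ (λ u → ∏ (λ i → ∏ (λ v → edge u v i)))
    ≡⟨ ∏-comm (λ u i → ∏ (λ v → edge u v i)) ⟩
  ∏ (λ i → independent G (column α i)) ∎
  where
  disjoint : Fin n → Fin n → Bool
  disjoint u v = not (adj G u v) ∨ not (anyFin (λ i → column α i u ∧ column α i v))
  edge : Fin n → Fin n → Fin _ → ℤ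
  edge u v i = 𝟙 (not (adj G u v) ∨ not (column α i u ∧ column α i v))

𝟙-goodColouring : ∀ {n} (G : Graph n) (ω : Fin n → ℕ) (a : Monomial) (α : Vec (Vec Bool (length a)) n) →
  𝟙 (goodColouring G ω a α)
    ≡ ∑ (λ U → sign U * ∏ (λ i → independentOfWeight G ω U (List.lookup a i) (column α i))) (allSubsets n)
𝟙-goodColouring {n} G ω a α = begin
  𝟙 (nonempty ∧ proper ∧ weighted)
    ≡⟨ trans (𝟙-∧ nonempty _) (cong (_*_ (𝟙 nonempty)) (𝟙-∧ proper weighted)) ⟩
  𝟙 nonempty * (𝟙 proper * 𝟙 weighted)
    ≡⟨ cong₂ _*_ (𝟙-nonempty α) (cong₂ _*_ (𝟙-proper G α) (𝟙-allFinB (λ i → weight ω (column α i) ≡ᵇ List.lookup a i))) ⟩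
  ∑ (λ U → sign U * Avoid U) (allSubsets n) * Rest
    ≡⟨ ∑-*ʳ Rest (λ U → sign U * Avoid U) (allSubsets n) ⟨
  ∑ (λ U → sign U * Avoid U * Rest) (allSubsets n)
    ≡⟨ ∑-cong (λ U → trans (*-assoc (sign U) _ _) (cong (_*_ (sign U)) (sym (distrib U)))) (allSubsets n) ⟩
  ∑ (λ U → sign U * ∏ (λ i → independentOfWeight G ω U (List.lookup a i) (column α i))) (allSubsets n) ∎
  where
  nonempty proper weighted : Bool
  nonempty = allFinB (λ v → anyFin (λ i → column α i v))
  proper   = allFinB (λ u → allFinB (λ v → not (adj G u v) ∨ not (anyFin (λ i → column α i u ∧ column α i v))))
  weighted = allFinB (λ i → weight ω (column α i) ≡ᵇ List.lookup a i)
  Avoid : Vec Bool n → ℤ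
  Avoid U = ∏ (λ i → avoids U (column α i))
  Rest : ℤ
  Rest = ∏ (λ i → independent G (column α i)) * ∏ (λ i → 𝟙 (weight ω (column α i) ≡ᵇ List.lookup a i))
  distrib : ∀ U → ∏ (λ i → independentOfWeight G ω U (List.lookup a i) (column α i)) ≡ Avoid U * Rest
  distrib U = trans (∏-distrib-* (λ i → avoids U (column α i)) _)
                    (cong (_*_ (Avoid U)) (∏-distrib-* (λ i → independent G (column α i)) _))

kromaticCoeff-∑ : ∀ {n} (G : Graph n) (ω : Fin n → ℕ) (a : Monomial) →
  + kromaticCoeff G ω a ≡ ∑ (λ U → sign U * ∏ᵢ (independentCount G ω U) a) (allSubsets n)
kromaticCoeff-∑ {n} G ω a = begin
  + kromaticCoeff G ω a
    ≡⟨ length-filter≡∑𝟙 (goodColouring G ω a) (allAssignments n k) ⟩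
  ∑ (𝟙 ∘ goodColouring G ω a) (allAssignments n k)
    ≡⟨ ∑-cong (𝟙-goodColouring G ω a) (allAssignments n k) ⟩
  ∑ (λ α → ∑ (λ U → sign U * Term U α) (allSubsets n)) (allAssignments n k)
    ≡⟨ ∑-comm _ (allAssignments n k) (allSubsets n) ⟩
  ∑ (λ U → ∑ (λ α → sign U * Term U α) (allAssignments n k)) (allSubsets n)
    ≡⟨ ∑-cong (λ U → trans (∑-*ˡ (sign U) (Term U) (allAssignments n k)) (cong (_*_ (sign U)) (columns U))) (allSubsets n) ⟩
  ∑ (λ U → sign U * ∏ᵢ (independentCount G ω U) a) (allSubsets n) ∎
  where
  k : ℕ
  k = length a
  Term : Vec Bool n → Vec (Vec Bool k) n → ℤ
  Term U α = ∏ (λ i → independentOfWeight G ω U (List.lookup a i) (column α i))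
  columns : ∀ U → ∑ (Term U) (allAssignments n k) ≡ ∏ᵢ (independentCount G ω U) a
  columns U = trans (∑-∏-columns n k _ (λ i → independentOfWeight-cong G ω U _)) (∏-lookup (independentCount G ω U) a)

δ : ℕ → ℤ
δ zero    = 1ℤ
δ (suc _) = 0ℤ

shift : ℕ → (ℕ → ℤ) → ℕ → ℤ
shift zero    f x       = f x
shift (suc k) f zero    = 0ℤ
shift (suc k) f (suc x) = shift k f x

times1+t^ : ℕ → (ℕ → ℤ) → ℕ → ℤ
times1+t^ k f x = f x + shift k f x

shift-cong : ∀ k {f g : ℕ → ℤ} → f ≗ g → shift k f ≗ shift k g
shift-cong zero    f≗g x       = f≗g x
shift-cong (suc k) f≗g zero    = refl
shift-cong (suc k) f≗g (suc x) = shift-cong k f≗g x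

times1+t^-cong : ∀ k {f g : ℕ → ℤ} → f ≗ g → times1+t^ k f ≗ times1+t^ k g
times1+t^-cong k f≗g x = cong₂ _+_ (f≗g x) (shift-cong k f≗g x)

shift-distrib-+ : ∀ k (f g : ℕ → ℤ) x → shift k (λ y → f y + g y) x ≡ shift k f x + shift k g x
shift-distrib-+ zero    f g x       = refl
shift-distrib-+ (suc k) f g zero    = refl
shift-distrib-+ (suc k) f g (suc x) = shift-distrib-+ k f g x

shift-*ˡ : ∀ k c (f : ℕ → ℤ) x → shift k (λ y → c * f y) x ≡ c * shift k f x
shift-*ˡ zero    c f x       = refl
shift-*ˡ (suc k) c f zero    = sym (*-zeroʳ c)
shift-*ˡ (suc k) c f (suc x) = shift-*ˡ k c f x

shift-∑ : ∀ k (F : A → ℕ → ℤ) xs x → shift k (λ y → ∑ (λ t → F t y) xs) x ≡ ∑ (λ t → shift k (F t) x) xs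
shift-∑ zero    F xs x       = refl
shift-∑ (suc k) F xs zero    = sym (∑-zero xs)
shift-∑ (suc k) F xs (suc x) = shift-∑ k F xs x

shift-shift : ∀ k l (f : ℕ → ℤ) → shift k (shift l f) ≗ shift (k ℕ.+ l) f
shift-shift zero    l f x       = refl
shift-shift (suc k) l f zero    = refl
shift-shift (suc k) l f (suc x) = shift-shift k l f x

times1+t^-comm : ∀ k l (f : ℕ → ℤ) → times1+t^ k (times1+t^ l f) ≗ times1+t^ l (times1+t^ k f)
times1+t^-comm k l f x = begin
  (f x + shift l f x) + shift k (times1+t^ l f) x
    ≡⟨ cong (_+_ (f x + shift l f x)) (trans (shift-distrib-+ k f (shift l f) x) (cong (_+_ (shift k f x)) kl≡lk)) ⟩
  (f x + shift l f x) + (shift k f x + shift l (shift k f) x)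
    ≡⟨ +-interchange (f x) (shift l f x) (shift k f x) (shift l (shift k f) x) ⟩
  (f x + shift k f x) + (shift l f x + shift l (shift k f) x)
    ≡⟨ cong (_+_ (f x + shift k f x)) (shift-distrib-+ l f (shift k f) x) ⟨
  (f x + shift k f x) + shift l (times1+t^ k f) x ∎
  where
  kl≡lk : shift k (shift l f) x ≡ shift l (shift k f) x
  kl≡lk = trans (shift-shift k l f x) (trans (cong (λ m → shift m f x) (ℕ.+-comm k l)) (sym (shift-shift l k f x)))

∑≤ : ℕ → (ℕ → ℤ) → ℤ
∑≤ zero    g = g 0
∑≤ (suc x) g = g 0 + ∑≤ x (g ∘ suc)

∑≤-cong : ∀ x {g h : ℕ → ℤ} → g ≗ h → ∑≤ x g ≡ ∑≤ x h
∑≤-cong zero    g≗h = g≗h 0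
∑≤-cong (suc x) g≗h = cong₂ _+_ (g≗h 0) (∑≤-cong x (g≗h ∘ suc))

∑≤-distrib-+ : ∀ x (g h : ℕ → ℤ) → ∑≤ x (λ j → g j + h j) ≡ ∑≤ x g + ∑≤ x h
∑≤-distrib-+ zero    g h = refl
∑≤-distrib-+ (suc x) g h rewrite ∑≤-distrib-+ x (g ∘ suc) (h ∘ suc) = +-interchange (g 0) (h 0) (∑≤ x (g ∘ suc)) (∑≤ x (h ∘ suc))

∑≤-*ˡ : ∀ x c (g : ℕ → ℤ) → ∑≤ x (λ j → c * g j) ≡ c * ∑≤ x g
∑≤-*ˡ zero    c g = refl
∑≤-*ˡ (suc x) c g rewrite ∑≤-*ˡ x c (g ∘ suc) = sym (*-distribˡ-+ c _ _)

∑≤-zero : ∀ x → ∑≤ x (λ _ → 0ℤ) ≡ 0ℤ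
∑≤-zero zero    = refl
∑≤-zero (suc x) = trans (+-identityˡ _) (∑≤-zero x)

∑≤-δ : ∀ x (g : ℕ → ℤ) → ∑≤ x (λ j → δ j * g j) ≡ g 0
∑≤-δ zero    g = *-identityˡ _
∑≤-δ (suc x) g = trans (cong₂ _+_ (*-identityˡ (g 0)) (trans (∑≤-cong x (λ j → *-zeroˡ (g (suc j)))) (∑≤-zero x)))
                       (+-identityʳ _)

0≤* : ∀ {a b} → 0ℤ ℤ.≤ a → 0ℤ ℤ.≤ b → 0ℤ ℤ.≤ a * b
0≤* {+ m} {+ n} _ _ = subst (0ℤ ℤ.≤_) (pos-* m n) (+≤+ z≤n)

0≤+ : ∀ {a b} → 0ℤ ℤ.≤ a → 0ℤ ℤ.≤ b → 0ℤ ℤ.≤ a + b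
0≤+ {+ m} {+ n} _ _ = subst (0ℤ ℤ.≤_) (pos-+ m n) (+≤+ z≤n)

∑≤-≢0 : ∀ x (g : ℕ → ℤ) → ∑≤ x g ≢ 0ℤ → ∃[ j ] (j ≤ x × g j ≢ 0ℤ)
∑≤-≢0 zero    g ≢0 = 0 , z≤n , ≢0
∑≤-≢0 (suc x) g ≢0 with g 0 ≟ 0ℤ
... | no  g0≢0 = 0 , z≤n , g0≢0
... | yes g0≡0 with ∑≤-≢0 x (g ∘ suc) (λ ≡0 → ≢0 (cong₂ _+_ g0≡0 ≡0))
...   | j , j≤x , gj≢0 = suc j , s≤s j≤x , gj≢0

∑≤-cong-≤ : ∀ x {g h : ℕ → ℤ} → (∀ j → j ≤ x → g j ≡ h j) → ∑≤ x g ≡ ∑≤ x h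
∑≤-cong-≤ zero    g≗h = g≗h 0 z≤n
∑≤-cong-≤ (suc x) g≗h = cong₂ _+_ (g≗h 0 z≤n) (∑≤-cong-≤ x (λ j j≤x → g≗h (suc j) (s≤s j≤x)))

∑≤-nonneg : ∀ x (g : ℕ → ℤ) → (∀ j → 0ℤ ℤ.≤ g j) → 0ℤ ℤ.≤ ∑≤ x g
∑≤-nonneg zero    g g≥0 = g≥0 0
∑≤-nonneg (suc x) g g≥0 = 0≤+ (g≥0 0) (∑≤-nonneg x (g ∘ suc) (g≥0 ∘ suc))

∑≤-≥ : ∀ x (g : ℕ → ℤ) → (∀ j → 0ℤ ℤ.≤ g j) → ∀ j → j ≤ x → g j ℤ.≤ ∑≤ x g
∑≤-≥ zero    g g≥0 .0      z≤n       = ≤-refl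
∑≤-≥ (suc x) g g≥0 zero    _         = i≤i+j (g 0) _ {{ℤ.nonNegative (∑≤-nonneg x (g ∘ suc) (g≥0 ∘ suc))}}
∑≤-≥ (suc x) g g≥0 (suc j) (s≤s j≤x) =
  ≤-trans (∑≤-≥ x (g ∘ suc) (g≥0 ∘ suc) j j≤x) (i≤j+i _ (g 0) {{ℤ.nonNegative (g≥0 0)}})

shift-< : ∀ k (f : ℕ → ℤ) x → x < k → shift k f x ≡ 0ℤ
shift-< (suc k) f zero    _         = refl
shift-< (suc k) f (suc x) (s≤s x<k) = shift-< k f x x<k

shift-self : ∀ k (f : ℕ → ℤ) → shift k f k ≡ f 0
shift-self zero    f = refl
shift-self (suc k) f = shift-self k f

shift-nonneg : ∀ k (f : ℕ → ℤ) → (∀ x → 0ℤ ℤ.≤ f x) → ∀ x → 0ℤ ℤ.≤ shift k f x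
shift-nonneg zero    f f≥0 x       = f≥0 x
shift-nonneg (suc k) f f≥0 zero    = ≤-refl
shift-nonneg (suc k) f f≥0 (suc x) = shift-nonneg k f f≥0 x

δ-nonneg : ∀ x → 0ℤ ℤ.≤ δ x
δ-nonneg zero    = +≤+ z≤n
δ-nonneg (suc x) = +≤+ z≤n

∏ᵢ-nonneg : ∀ (f : ℕ → ℤ) → (∀ x → 0ℤ ℤ.≤ f x) → ∀ a → 0ℤ ℤ.≤ ∏ᵢ f a
∏ᵢ-nonneg f f≥0 []      = +≤+ z≤n
∏ᵢ-nonneg f f≥0 (x ∷ a) = 0≤* (f≥0 x) (∏ᵢ-nonneg f f≥0 a)

_⋆_ : (ℕ → ℤ) → (ℕ → ℤ) → ℕ → ℤ
(h ⋆ f) x = ∑≤ x (λ j → h j * f (x ∸ j))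

δ-⋆ : ∀ (f : ℕ → ℤ) → δ ⋆ f ≗ f
δ-⋆ f x = ∑≤-δ x (λ j → f (x ∸ j))

shift-δ-⋆ : ∀ k (f : ℕ → ℤ) → shift k δ ⋆ f ≗ shift k f
shift-δ-⋆ zero    f x       = δ-⋆ f x
shift-δ-⋆ (suc k) f zero    = *-zeroˡ (f 0)
shift-δ-⋆ (suc k) f (suc x) = trans (+-identityˡ _) (shift-δ-⋆ k f x)

times1+t^-δ-⋆ : ∀ k (f : ℕ → ℤ) → times1+t^ k δ ⋆ f ≗ times1+t^ k f
times1+t^-δ-⋆ k f x = trans (∑≤-cong x (λ j → *-distribʳ-+ (f (x ∸ j)) (δ j) (shift k δ j)))
  (trans (∑≤-distrib-+ x _ _) (cong₂ _+_ (δ-⋆ f x) (shift-δ-⋆ k f x)))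

-- (F ⊛ G) a = Σ_{c + d = a} F c · G d, the coefficient of x^a in the product.
_⊛_ : Series → Series → Series
(F ⊛ G) []      = F [] * G []
(F ⊛ G) (x ∷ a) = ∑≤ x (λ j → ((λ c → F (j ∷ c)) ⊛ (λ d → G ((x ∸ j) ∷ d))) a)

⊛-congˡ : ∀ {F F′} G → F ≗ F′ → F ⊛ G ≗ F′ ⊛ G
⊛-congˡ G F≗F′ []      = cong (_* G []) (F≗F′ [])
⊛-congˡ G F≗F′ (x ∷ a) = ∑≤-cong x (λ j → ⊛-congˡ _ (F≗F′ ∘ (j ∷_)) a)

⊛-congʳ : ∀ F {G G′} → G ≗ G′ → F ⊛ G ≗ F ⊛ G′
⊛-congʳ F G≗G′ []      = cong (_*_ (F [])) (G≗G′ [])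
⊛-congʳ F G≗G′ (x ∷ a) = ∑≤-cong x (λ j → ⊛-congʳ _ (λ d → G≗G′ ((x ∸ j) ∷ d)) a)

⊛-distribˡ-+ : ∀ F F′ G a → ((λ c → F c + F′ c) ⊛ G) a ≡ (F ⊛ G) a + (F′ ⊛ G) a
⊛-distribˡ-+ F F′ G []      = *-distribʳ-+ (G []) (F []) (F′ [])
⊛-distribˡ-+ F F′ G (x ∷ a) = trans (∑≤-cong x (λ j → ⊛-distribˡ-+ _ _ _ a)) (∑≤-distrib-+ x _ _)

⊛-distribʳ-+ : ∀ F G H a → (F ⊛ (λ d → G d + H d)) a ≡ (F ⊛ G) a + (F ⊛ H) a
⊛-distribʳ-+ F G H []      = *-distribˡ-+ (F []) (G []) (H [])
⊛-distribʳ-+ F G H (x ∷ a) = trans (∑≤-cong x (λ j → ⊛-distribʳ-+ _ _ _ a)) (∑≤-distrib-+ x _ _)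

⊛-*ˡ : ∀ F G z a → ((λ c → z * F c) ⊛ G) a ≡ z * (F ⊛ G) a
⊛-*ˡ F G z []      = *-assoc z (F []) (G [])
⊛-*ˡ F G z (x ∷ a) = trans (∑≤-cong x (λ j → ⊛-*ˡ _ _ z a)) (∑≤-*ˡ x z _)

⊛-*ʳ : ∀ F G z a → (F ⊛ (λ d → z * G d)) a ≡ z * (F ⊛ G) a
⊛-*ʳ F G z []      = *-swapˡ (F []) z (G [])
⊛-*ʳ F G z (x ∷ a) = trans (∑≤-cong x (λ j → ⊛-*ʳ _ _ z a)) (∑≤-*ˡ x z _)

⊛-zeroʳ : ∀ F a → (F ⊛ (λ _ → 0ℤ)) a ≡ 0ℤ
⊛-zeroʳ F []      = *-zeroʳ (F [])
⊛-zeroʳ F (x ∷ a) = trans (∑≤-cong x (λ j → ⊛-zeroʳ _ a)) (∑≤-zero x)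

⊛-negˡ : ∀ F G a → ((λ c → - F c) ⊛ G) a ≡ - (F ⊛ G) a
⊛-negˡ F G a = trans (⊛-congˡ G (λ c → sym (-1*i≡-i (F c))) a) (trans (⊛-*ˡ F G -1ℤ a) (-1*i≡-i _))

⊛-negʳ : ∀ F G a → (F ⊛ (λ d → - G d)) a ≡ - (F ⊛ G) a
⊛-negʳ F G a = trans (⊛-congʳ F (λ d → sym (-1*i≡-i (G d))) a) (trans (⊛-*ʳ F G -1ℤ a) (-1*i≡-i _))

⊛-distribˡ-- : ∀ F F′ G a → ((λ c → F c - F′ c) ⊛ G) a ≡ (F ⊛ G) a - (F′ ⊛ G) a
⊛-distribˡ-- F F′ G a = trans (⊛-distribˡ-+ F (λ c → - F′ c) G a) (cong (_+_ ((F ⊛ G) a)) (⊛-negˡ F′ G a))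

⊛-distribʳ-- : ∀ F G H a → (F ⊛ (λ d → G d - H d)) a ≡ (F ⊛ G) a - (F ⊛ H) a
⊛-distribʳ-- F G H a = trans (⊛-distribʳ-+ F G (λ d → - H d) a) (cong (_+_ ((F ⊛ G) a)) (⊛-negʳ F H a))

⊛-∑ʳ : ∀ F (c : A → ℤ) (H : A → Series) xs a →
  (F ⊛ (λ d → ∑ (λ t → c t * H t d) xs)) a ≡ ∑ (λ t → c t * (F ⊛ H t) a) xs
⊛-∑ʳ F c H []       a = ⊛-zeroʳ F a
⊛-∑ʳ F c H (t ∷ xs) a = trans (⊛-distribʳ-+ F (λ d → c t * H t d) _ a)
  (cong₂ _+_ (⊛-*ʳ F (H t) (c t) a) (⊛-∑ʳ F c H xs a))

∏ᵢ-⊛-∏ᵢ : ∀ (h f : ℕ → ℤ) → ∏ᵢ h ⊛ ∏ᵢ f ≗ ∏ᵢ (h ⋆ f)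
∏ᵢ-⊛-∏ᵢ h f []      = refl
∏ᵢ-⊛-∏ᵢ h f (x ∷ a) = begin
  ∑≤ x (λ j → ((λ c → h j * ∏ᵢ h c) ⊛ (λ d → f (x ∸ j) * ∏ᵢ f d)) a)
    ≡⟨ ∑≤-cong x (λ j → trans (⊛-*ˡ (∏ᵢ h) _ (h j) a) (cong (_*_ (h j)) (⊛-*ʳ (∏ᵢ h) (∏ᵢ f) (f (x ∸ j)) a))) ⟩
  ∑≤ x (λ j → h j * (f (x ∸ j) * (∏ᵢ h ⊛ ∏ᵢ f) a))
    ≡⟨ ∑≤-cong x (λ j → cong (λ p → h j * (f (x ∸ j) * p)) (∏ᵢ-⊛-∏ᵢ h f a)) ⟩
  ∑≤ x (λ j → h j * (f (x ∸ j) * ∏ᵢ (h ⋆ f) a))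
    ≡⟨ ∑≤-cong x (λ j → *-rotate (h j) (f (x ∸ j)) (∏ᵢ (h ⋆ f) a)) ⟩
  ∑≤ x (λ j → ∏ᵢ (h ⋆ f) a * (h j * f (x ∸ j)))
    ≡⟨ ∑≤-*ˡ x (∏ᵢ (h ⋆ f) a) _ ⟩
  ∏ᵢ (h ⋆ f) a * (h ⋆ f) x
    ≡⟨ *-comm (∏ᵢ (h ⋆ f) a) _ ⟩
  (h ⋆ f) x * ∏ᵢ (h ⋆ f) a ∎

∏ᵢδ-⊛ : ∀ G → ∏ᵢ δ ⊛ G ≗ G
∏ᵢδ-⊛ G []      = *-identityˡ (G [])
∏ᵢδ-⊛ G (x ∷ a) = trans (∑≤-cong x (λ j → trans (⊛-*ˡ (∏ᵢ δ) _ (δ j) a) (cong (_*_ (δ j)) (∏ᵢδ-⊛ _ a))))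
  (∑≤-δ x (λ j → G ((x ∸ j) ∷ a)))

-- p̄₁ k = ∏_i (1 + x_i^k) − 1 is the basis element of the one-part partition (k).
p̄₁ : ℕ → Series
p̄₁ k c = ∏ᵢ (times1+t^ k δ) c - ∏ᵢ δ c

p̄₁-⊛-∏ᵢ : ∀ k (f : ℕ → ℤ) a → (p̄₁ k ⊛ ∏ᵢ f) a ≡ ∏ᵢ (times1+t^ k f) a - ∏ᵢ f a
p̄₁-⊛-∏ᵢ k f a = trans (⊛-distribˡ-- (∏ᵢ (times1+t^ k δ)) (∏ᵢ δ) (∏ᵢ f) a)
  (cong₂ _-_ (trans (∏ᵢ-⊛-∏ᵢ (times1+t^ k δ) f a) (∏ᵢ-cong (times1+t^-δ-⋆ k f) a)) (∏ᵢδ-⊛ (∏ᵢ f) a))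

sumFin-suc : ∀ ℓ (g : Fin (suc ℓ) → ℕ) → sumFin g ≡ g zero ℕ.+ sumFin (g ∘ suc)
sumFin-suc ℓ g = cong (g zero ℕ.+_) (cong sumℕ (trans (map-tabulate suc g) (sym (map-tabulate id (g ∘ suc)))))

weight-∷ : ∀ {ℓ} (w : Fin (suc ℓ) → ℕ) c S →
  weight w (Vec.lookup (c ∷ S)) ≡ (if c then w zero else 0) ℕ.+ weight (w ∘ suc) (Vec.lookup S)
weight-∷ {ℓ} w c S = sumFin-suc ℓ _

𝟙-+-≡ᵇ : ∀ k x m → 𝟙 (k ℕ.+ x ≡ᵇ m) ≡ shift k (λ m′ → 𝟙 (x ≡ᵇ m′)) m
𝟙-+-≡ᵇ zero    x m       = refl
𝟙-+-≡ᵇ (suc k) x zero    = refl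
𝟙-+-≡ᵇ (suc k) x (suc m) = 𝟙-+-≡ᵇ k x m

independent-edgeless : ∀ ℓ S → independent (edgeless ℓ) S ≡ 1ℤ
independent-edgeless ℓ S = trans (∏-cong {ℓ} (λ u → ∏-one ℓ)) (∏-one ℓ)

avoidingCount : ∀ {ℓ} → (Fin ℓ → ℕ) → Vec Bool ℓ → ℕ → ℤ
avoidingCount {ℓ} w T m = ∑ (λ S → avoids T (Vec.lookup S) * 𝟙 (weight w (Vec.lookup S) ≡ᵇ m)) (allSubsets ℓ)

independentCount-edgeless : ∀ {ℓ} (w : Fin ℓ → ℕ) T m → independentCount (edgeless ℓ) w T m ≡ avoidingCount w T m
independentCount-edgeless {ℓ} w T m = ∑-cong (λ S → cong (_*_ (avoids T (Vec.lookup S)))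
  (trans (cong (_* 𝟙 (weight w (Vec.lookup S) ≡ᵇ m)) (independent-edgeless ℓ (Vec.lookup S))) (*-identityˡ _))) (allSubsets ℓ)

avoidingCount-∷ : ∀ {ℓ} (w : Fin (suc ℓ) → ℕ) b T →
  avoidingCount w (b ∷ T) ≗ (if b then avoidingCount (w ∘ suc) T else times1+t^ (w zero) (avoidingCount (w ∘ suc) T))
avoidingCount-∷ {ℓ} w true T m = trans (∑-allSubsets-suc ℓ _) (∑-cong (λ S →
  trans (cong₂ (λ x y → 0ℤ * Av S * 𝟙 (x ≡ᵇ m) + 1ℤ * Av S * 𝟙 (y ≡ᵇ m)) (weight-∷ w true S) (weight-∷ w false S))
        (drop-first (Av S) (𝟙 (w zero ℕ.+ wt S ≡ᵇ m)) (𝟙 (wt S ≡ᵇ m)))) (allSubsets ℓ))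
  where
  Av : Vec Bool ℓ → ℤ
  Av S = avoids T (Vec.lookup S)
  wt : Vec Bool ℓ → ℕ
  wt S = weight (w ∘ suc) (Vec.lookup S)
  drop-first : ∀ p x y → 0ℤ * p * x + 1ℤ * p * y ≡ p * y
  drop-first = solve-∀
avoidingCount-∷ {ℓ} w false T m = begin
  avoidingCount w (false ∷ T) m
    ≡⟨ ∑-allSubsets-suc ℓ _ ⟩
  ∑ (λ S → 1ℤ * Av S * 𝟙 (weight w (Vec.lookup (true ∷ S)) ≡ᵇ m)
         + 1ℤ * Av S * 𝟙 (weight w (Vec.lookup (false ∷ S)) ≡ᵇ m)) (allSubsets ℓ)
    ≡⟨ ∑-cong (λ S → cong₂ (λ x y → 1ℤ * Av S * 𝟙 (x ≡ᵇ m) + 1ℤ * Av S * 𝟙 (y ≡ᵇ m))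
                          (weight-∷ w true S) (weight-∷ w false S)) (allSubsets ℓ) ⟩
  ∑ (λ S → 1ℤ * Av S * 𝟙 (w zero ℕ.+ wt S ≡ᵇ m) + 1ℤ * Av S * 𝟙 (wt S ≡ᵇ m)) (allSubsets ℓ)
    ≡⟨ ∑-cong (λ S → trans (swap-units (Av S) _ _)
                           (cong (λ z → Av S * 𝟙 (wt S ≡ᵇ m) + Av S * z) (𝟙-+-≡ᵇ (w zero) (wt S) m))) (allSubsets ℓ) ⟩
  ∑ (λ S → Av S * 𝟙 (wt S ≡ᵇ m) + Av S * shift (w zero) (λ m′ → 𝟙 (wt S ≡ᵇ m′)) m) (allSubsets ℓ)
    ≡⟨ ∑-distrib-+ _ _ (allSubsets ℓ) ⟩
  avoidingCount (w ∘ suc) T m + ∑ (λ S → Av S * shift (w zero) (λ m′ → 𝟙 (wt S ≡ᵇ m′)) m) (allSubsets ℓ)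
    ≡⟨ cong (_+_ (avoidingCount (w ∘ suc) T m)) (∑-cong (λ S → shift-*ˡ (w zero) (Av S) _ m) (allSubsets ℓ)) ⟨
  avoidingCount (w ∘ suc) T m + ∑ (λ S → shift (w zero) (λ m′ → Av S * 𝟙 (wt S ≡ᵇ m′)) m) (allSubsets ℓ)
    ≡⟨ cong (_+_ (avoidingCount (w ∘ suc) T m)) (shift-∑ (w zero) (λ S m′ → Av S * 𝟙 (wt S ≡ᵇ m′)) (allSubsets ℓ) m) ⟨
  times1+t^ (w zero) (avoidingCount (w ∘ suc) T) m ∎
  where
  Av : Vec Bool ℓ → ℤ
  Av S = avoids T (Vec.lookup S)
  wt : Vec Bool ℓ → ℕ
  wt S = weight (w ∘ suc) (Vec.lookup S)
  swap-units : ∀ p x y → 1ℤ * p * x + 1ℤ * p * y ≡ p * y + p * x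
  swap-units = solve-∀

weightEnumerator : (μ : List ℕ) → Vec Bool (length μ) → ℕ → ℤ
weightEnumerator []      []          = δ
weightEnumerator (k ∷ μ) (true  ∷ T) = weightEnumerator μ T
weightEnumerator (k ∷ μ) (false ∷ T) = times1+t^ k (weightEnumerator μ T)

avoidingCount≗weightEnumerator : ∀ μ T → avoidingCount (List.lookup μ) T ≗ weightEnumerator μ T
avoidingCount≗weightEnumerator []      []          zero    = refl
avoidingCount≗weightEnumerator []      []          (suc m) = refl
avoidingCount≗weightEnumerator (k ∷ μ) (true  ∷ T) m =
  trans (avoidingCount-∷ (List.lookup (k ∷ μ)) true T m) (avoidingCount≗weightEnumerator μ T m)
avoidingCount≗weightEnumerator (k ∷ μ) (false ∷ T) m =
  trans (avoidingCount-∷ (List.lookup (k ∷ μ)) false T m) (times1+t^-cong k (avoidingCount≗weightEnumerator μ T) m)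

p̄ : List ℕ → Series
p̄ μ a = + pbarCoeff μ a

p̄-∑ : ∀ μ a → p̄ μ a ≡ ∑ (λ T → sign T * ∏ᵢ (weightEnumerator μ T) a) (allSubsets (length μ))
p̄-∑ μ a = trans (kromaticCoeff-∑ (edgeless (length μ)) (List.lookup μ) a)
  (∑-cong (λ T → cong (_*_ (sign T)) (∏ᵢ-cong (λ m → trans (independentCount-edgeless (List.lookup μ) T m)
                                                            (avoidingCount≗weightEnumerator μ T m)) a))
          (allSubsets (length μ)))

p̄₁-⊛-p̄ : ∀ k μ a → (p̄₁ k ⊛ p̄ μ) a ≡
  ∑ (λ T → sign T * (∏ᵢ (times1+t^ k (weightEnumerator μ T)) a - ∏ᵢ (weightEnumerator μ T) a)) (allSubsets (length μ))
p̄₁-⊛-p̄ k μ a = trans (⊛-congʳ (p̄₁ k) (p̄-∑ μ) a) (trans (⊛-∑ʳ (p̄₁ k) sign (∏ᵢ ∘ weightEnumerator μ) (allSubsets (length μ)) a)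
  (∑-cong (λ T → cong (_*_ (sign T)) (p̄₁-⊛-∏ᵢ k (weightEnumerator μ T) a)) (allSubsets (length μ))))

p̄-∷ : ∀ k μ → p̄ (k ∷ μ) ≗ p̄₁ k ⊛ p̄ μ
p̄-∷ k μ a = begin
  p̄ (k ∷ μ) a
    ≡⟨ p̄-∑ (k ∷ μ) a ⟩
  ∑ (λ T → sign T * ∏ᵢ (weightEnumerator (k ∷ μ) T) a) (allSubsets (suc (length μ)))
    ≡⟨ ∑-allSubsets-suc (length μ) _ ⟩
  ∑ (λ T → -1ℤ * sign T * ∏ᵢ (V T) a + 1ℤ * sign T * ∏ᵢ (times1+t^ k (V T)) a) (allSubsets (length μ))
    ≡⟨ ∑-cong (λ T → collect (sign T) _ _) (allSubsets (length μ)) ⟩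
  ∑ (λ T → sign T * (∏ᵢ (times1+t^ k (V T)) a - ∏ᵢ (V T) a)) (allSubsets (length μ))
    ≡⟨ p̄₁-⊛-p̄ k μ a ⟨
  (p̄₁ k ⊛ p̄ μ) a ∎
  where
  V : Vec Bool (length μ) → ℕ → ℤ
  V = weightEnumerator μ
  collect : ∀ s p q → -1ℤ * s * p + 1ℤ * s * q ≡ s * (q - p)
  collect = solve-∀

p̄₁-⊛-p̄₁-⊛-p̄ : ∀ k l μ a → (p̄₁ k ⊛ (p̄₁ l ⊛ p̄ μ)) a ≡
  ∑ (λ T → sign T * ((∏ᵢ (times1+t^ k (times1+t^ l (weightEnumerator μ T))) a - ∏ᵢ (times1+t^ l (weightEnumerator μ T)) a)
                   - (∏ᵢ (times1+t^ k (weightEnumerator μ T)) a - ∏ᵢ (weightEnumerator μ T) a))) (allSubsets (length μ))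
p̄₁-⊛-p̄₁-⊛-p̄ k l μ a =
  trans (⊛-congʳ (p̄₁ k) (p̄₁-⊛-p̄ l μ) a)
  (trans (⊛-∑ʳ (p̄₁ k) sign (λ T d → ∏ᵢ (times1+t^ l (V T)) d - ∏ᵢ (V T) d) (allSubsets (length μ)) a)
  (∑-cong (λ T → cong (_*_ (sign T)) (trans (⊛-distribʳ-- (p̄₁ k) (∏ᵢ (times1+t^ l (V T))) (∏ᵢ (V T)) a)
    (cong₂ _-_ (p̄₁-⊛-∏ᵢ k (times1+t^ l (V T)) a) (p̄₁-⊛-∏ᵢ k (V T) a)))) (allSubsets (length μ))))
  where
  V : Vec Bool (length μ) → ℕ → ℤ
  V = weightEnumerator μ

p̄₁-⊛-comm : ∀ k l μ → p̄₁ k ⊛ (p̄₁ l ⊛ p̄ μ) ≗ p̄₁ l ⊛ (p̄₁ k ⊛ p̄ μ)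
p̄₁-⊛-comm k l μ a = trans (p̄₁-⊛-p̄₁-⊛-p̄ k l μ a) (trans (∑-cong (λ T → cong (_*_ (sign T))
    (trans (cong (λ z → z - ∏ᵢ (times1+t^ l (V T)) a - (∏ᵢ (times1+t^ k (V T)) a - ∏ᵢ (V T) a)) (∏ᵢ-cong (times1+t^-comm k l (V T)) a))
           (exchange (∏ᵢ (times1+t^ l (times1+t^ k (V T))) a) (∏ᵢ (times1+t^ l (V T)) a) (∏ᵢ (times1+t^ k (V T)) a) (∏ᵢ (V T) a))))
    (allSubsets (length μ)))
  (sym (p̄₁-⊛-p̄₁-⊛-p̄ l k μ a)))
  where
  V : Vec Bool (length μ) → ℕ → ℤ
  V = weightEnumerator μ
  exchange : ∀ w x y z → (w - x) - (y - z) ≡ (w - y) - (x - z)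
  exchange = solve-∀

p̄-↭ : ∀ {μ ν} → μ ↭ ν → p̄ μ ≗ p̄ ν
p̄-↭ ↭.refl                      a = refl
p̄-↭ (↭.prep {xs} {ys} x p)      a = trans (p̄-∷ x xs a) (trans (⊛-congʳ (p̄₁ x) (p̄-↭ p) a) (sym (p̄-∷ x ys a)))
p̄-↭ (↭.swap {xs} {ys} x y p)    a = begin
  p̄ (x ∷ y ∷ xs) a               ≡⟨ trans (p̄-∷ x (y ∷ xs) a) (⊛-congʳ (p̄₁ x) (p̄-∷ y xs) a) ⟩
  (p̄₁ x ⊛ (p̄₁ y ⊛ p̄ xs)) a     ≡⟨ p̄₁-⊛-comm x y xs a ⟩
  (p̄₁ y ⊛ (p̄₁ x ⊛ p̄ xs)) a     ≡⟨ ⊛-congʳ (p̄₁ y) (λ d → ⊛-congʳ (p̄₁ x) (p̄-↭ p) d) a ⟩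
  (p̄₁ y ⊛ (p̄₁ x ⊛ p̄ ys)) a     ≡⟨ trans (p̄-∷ y (x ∷ ys) a) (⊛-congʳ (p̄₁ y) (p̄-∷ x ys) a) ⟨
  p̄ (y ∷ x ∷ ys) a ∎
p̄-↭ (↭.trans p q)               a = trans (p̄-↭ p a) (p̄-↭ q a)

-- Triangularity of p̄

data Split : Monomial → Monomial → Monomial → Set where
  []  : Split [] [] []
  _∷_ : ∀ {x a c d j} → j ≤ x → Split a c d → Split (x ∷ a) (j ∷ c) ((x ∸ j) ∷ d)

Split-degree : ∀ {a c d} → Split a c d → degree c ℕ.+ degree d ≡ degree a
Split-degree []                                = refl
Split-degree (_∷_ {x} {a} {c} {d} {j} j≤x s) =
  trans (ℕ-+-interchange j (degree c) (x ∸ j) (degree d)) (cong₂ ℕ._+_ (ℕ.m+[n∸m]≡n j≤x) (Split-degree s))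

⊛-≢0 : ∀ F G a → (F ⊛ G) a ≢ 0ℤ → ∃[ c ] ∃[ d ] (Split a c d × F c ≢ 0ℤ × G d ≢ 0ℤ)
⊛-≢0 F G []      ≢0 = [] , [] , [] , (λ ≡0 → ≢0 (cong (_* G []) ≡0)) , (λ ≡0 → ≢0 (trans (cong (F [] *_) ≡0) (*-zeroʳ (F []))))
⊛-≢0 F G (x ∷ a) ≢0 with ∑≤-≢0 x _ ≢0
... | j , j≤x , ≢0′ with ⊛-≢0 (λ c → F (j ∷ c)) (λ d → G ((x ∸ j) ∷ d)) a ≢0′
...   | c , d , s , Fc≢0 , Gd≢0 = j ∷ c , (x ∸ j) ∷ d , j≤x ∷ s , Fc≢0 , Gd≢0

⊛-cong-Split : ∀ F G G′ a → (∀ {c d} → Split a c d → F c * G d ≡ F c * G′ d) → (F ⊛ G) a ≡ (F ⊛ G′) a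
⊛-cong-Split F G G′ []      eq = eq []
⊛-cong-Split F G G′ (x ∷ a) eq = ∑≤-cong-≤ x (λ j j≤x → ⊛-cong-Split _ _ _ a (λ s → eq (j≤x ∷ s)))

⊛-nonneg : ∀ F G → (∀ c → 0ℤ ℤ.≤ F c) → (∀ d → 0ℤ ℤ.≤ G d) → ∀ a → 0ℤ ℤ.≤ (F ⊛ G) a
⊛-nonneg F G F≥0 G≥0 []      = 0≤* (F≥0 []) (G≥0 [])
⊛-nonneg F G F≥0 G≥0 (x ∷ a) = ∑≤-nonneg x _ (λ j → ⊛-nonneg _ _ (F≥0 ∘ (j ∷_)) (λ d → G≥0 ((x ∸ j) ∷ d)) a)

⊛-≥ : ∀ F G → (∀ c → 0ℤ ℤ.≤ F c) → (∀ d → 0ℤ ℤ.≤ G d) → ∀ {a c d} → Split a c d → F c * G d ℤ.≤ (F ⊛ G) a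
⊛-≥ F G F≥0 G≥0 []                          = ≤-refl
⊛-≥ F G F≥0 G≥0 (_∷_ {x} {a} {j = j} j≤x s) =
  ≤-trans (⊛-≥ (λ c → F (j ∷ c)) (λ d → G ((x ∸ j) ∷ d)) (F≥0 ∘ (j ∷_)) (λ d → G≥0 ((x ∸ j) ∷ d)) s)
          (∑≤-≥ x _ (λ i → ⊛-nonneg _ _ (F≥0 ∘ (i ∷_)) (λ d → G≥0 ((x ∸ i) ∷ d)) a) j j≤x)

p̄₁-nonneg : ∀ k c → 0ℤ ℤ.≤ p̄₁ k c
p̄₁-nonneg k []      = +≤+ z≤n
p̄₁-nonneg k (x ∷ c) = subst (0ℤ ℤ.≤_) (sym (expand (δ x) (shift k δ x) (∏ᵢ (times1+t^ k δ) c) (∏ᵢ δ c)))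
  (0≤+ (0≤* (δ-nonneg x) (p̄₁-nonneg k c)) (0≤* (shift-nonneg k δ δ-nonneg x) (∏ᵢ-nonneg _ 1+t^k≥0 c)))
  where
  1+t^k≥0 : ∀ x → 0ℤ ℤ.≤ times1+t^ k δ x
  1+t^k≥0 x = 0≤+ (δ-nonneg x) (shift-nonneg k δ δ-nonneg x)
  expand : ∀ z s P Q → (z + s) * P - z * Q ≡ z * (P - Q) + s * P
  expand = solve-∀

p̄-nonneg : ∀ μ a → 0ℤ ℤ.≤ p̄ μ a
p̄-nonneg μ a = +≤+ z≤n

p̄₁-low : ∀ k c → degree c < k → p̄₁ k c ≡ 0ℤ
p̄₁-low k c deg<k = trans (cong (_- ∏ᵢ δ c) (∏ᵢ-low c deg<k)) (+-inverseʳ (∏ᵢ δ c))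
  where
  ∏ᵢ-low : ∀ c → degree c < k → ∏ᵢ (times1+t^ k δ) c ≡ ∏ᵢ δ c
  ∏ᵢ-low []      _     = refl
  ∏ᵢ-low (x ∷ c) deg<k = cong₂ _*_
    (trans (cong (_+_ (δ x)) (shift-< k δ x (ℕ.≤-<-trans (ℕ.m≤m+n x (degree c)) deg<k))) (+-identityʳ (δ x)))
    (∏ᵢ-low c (ℕ.≤-<-trans (ℕ.m≤n+m (degree c) x) deg<k))

p̄₁-≢0 : ∀ k c → p̄₁ k c ≢ 0ℤ → k ≤ degree c
p̄₁-≢0 k c ≢0 with k ℕ.≤? degree c
... | yes k≤deg = k≤deg
... | no  k≰deg = ⊥-elim (≢0 (p̄₁-low k c (ℕ.≰⇒> k≰deg)))

p̄-≢0 : ∀ μ a → p̄ μ a ≢ 0ℤ → degree μ ≤ degree a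
p̄-≢0 []      a ≢0 = z≤n
p̄-≢0 (k ∷ μ) a ≢0 =
  let c , d , s , p̄₁c≢0 , p̄d≢0 = ⊛-≢0 (p̄₁ k) (p̄ μ) a (≢0 ∘ trans (p̄-∷ k μ a))
  in subst (k ℕ.+ degree μ ≤_) (Split-degree s) (ℕ.+-mono-≤ (p̄₁-≢0 k c p̄₁c≢0) (p̄-≢0 μ d p̄d≢0))

zeros : Monomial → Monomial
zeros = map (λ _ → 0)

Split-zeros : ∀ a → Split a (zeros a) a
Split-zeros []      = []
Split-zeros (x ∷ a) = z≤n ∷ Split-zeros a

weightEnumerator-zero : ∀ μ → All (0 <_) μ → ∀ T → weightEnumerator μ T 0 ≡ 1ℤ
weightEnumerator-zero []          _       []          = refl
weightEnumerator-zero (suc k ∷ μ) (_ ∷ μ>0) (true  ∷ T) = weightEnumerator-zero μ μ>0 T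
weightEnumerator-zero (suc k ∷ μ) (_ ∷ μ>0) (false ∷ T) = trans (+-identityʳ _) (weightEnumerator-zero μ μ>0 T)

p̄-0∷ : ∀ μ → All (0 <_) μ → ∀ a → p̄ μ (0 ∷ a) ≡ p̄ μ a
p̄-0∷ μ μ>0 a = trans (p̄-∑ μ (0 ∷ a)) (trans (∑-cong (λ T → cong (_*_ (sign T))
  (trans (cong (_* ∏ᵢ (weightEnumerator μ T) a) (weightEnumerator-zero μ μ>0 T)) (*-identityˡ _))) (allSubsets (length μ)))
  (sym (p̄-∑ μ a)))

p̄₁-single : ∀ k a → p̄₁ (suc k) (suc k ∷ zeros a) ≡ 1ℤ
p̄₁-single k a = cong₂ (λ u v → (0ℤ + u) * v - 0ℤ * ∏ᵢ δ (zeros a)) (shift-self k δ) (∏ᵢ-zeros a)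
  where
  ∏ᵢ-zeros : ∀ a → ∏ᵢ (times1+t^ (suc k) δ) (zeros a) ≡ 1ℤ
  ∏ᵢ-zeros []      = refl
  ∏ᵢ-zeros (x ∷ a) = trans (*-identityˡ _) (∏ᵢ-zeros a)

p̄-diagonal : ∀ μ → All (0 <_) μ → 1ℤ ℤ.≤ p̄ μ μ
p̄-diagonal []          _         = ≤-refl
p̄-diagonal (suc k ∷ μ) (_ ∷ μ>0) = subst (1ℤ ℤ.≤_) (sym (p̄-∷ (suc k) μ (suc k ∷ μ)))
  (≤-trans (subst (1ℤ ℤ.≤_) (sym main-term) (p̄-diagonal μ μ>0))
           (⊛-≥ (p̄₁ (suc k)) (p̄ μ) (p̄₁-nonneg (suc k)) (p̄-nonneg μ) (_∷_ {x = suc k} {j = suc k} ℕ.≤-refl (Split-zeros μ))))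
  where
  main-term : p̄₁ (suc k) (suc k ∷ zeros μ) * p̄ μ ((suc k ∸ suc k) ∷ μ) ≡ p̄ μ μ
  main-term = begin
    p̄₁ (suc k) (suc k ∷ zeros μ) * p̄ μ ((k ∸ k) ∷ μ) ≡⟨ cong₂ (λ u z → u * p̄ μ (z ∷ μ)) (p̄₁-single k μ) (ℕ.n∸n≡0 k) ⟩
    1ℤ * p̄ μ (0 ∷ μ)                                  ≡⟨ *-identityˡ _ ⟩
    p̄ μ (0 ∷ μ)                                       ≡⟨ p̄-0∷ μ μ>0 μ ⟩
    p̄ μ μ                                             ∎

nonzeros : Monomial → ℕ
nonzeros []          = 0
nonzeros (zero  ∷ a) = nonzeros a
nonzeros (suc _ ∷ a) = suc (nonzeros a)

multiplicity : ℕ → List ℕ → ℕ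
multiplicity y []      = 0
multiplicity y (x ∷ a) = (if x ≡ᵇ y then 1 else 0) ℕ.+ multiplicity y a

degree≡0 : ∀ a → degree a ≡ 0 → nonzeros a ≡ 0 × (∀ y → 0 < y → multiplicity y a ≡ 0)
degree≡0 []         _   = refl , (λ _ _ → refl)
degree≡0 (zero ∷ a) deg with degree≡0 a deg
... | nz≡0 , mult≡0 = nz≡0 , λ { (suc y) y>0 → mult≡0 (suc y) y>0 }

Split-degree≡0 : ∀ {a c d} → Split a c d → degree c ≡ 0 → d ≡ a
Split-degree≡0 []                     _   = refl
Split-degree≡0 (_∷_ {x} {j = zero} _ s) deg = cong (x ∷_) (Split-degree≡0 s deg)

p̄₁-0∷ : ∀ k c → p̄₁ (suc k) (0 ∷ c) ≡ p̄₁ (suc k) c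
p̄₁-0∷ k c = units (∏ᵢ (times1+t^ (suc k) δ) c) (∏ᵢ δ c)
  where
  units : ∀ P Q → (1ℤ + 0ℤ) * P - 1ℤ * Q ≡ P - Q
  units = solve-∀

add-part : ∀ x k a → suc k ≤ x →
  nonzeros (x ∷ a) ≤ suc (nonzeros ((x ∸ suc k) ∷ a))
  × (nonzeros (x ∷ a) ≡ suc (nonzeros ((x ∸ suc k) ∷ a)) → ∀ y → 0 < y → multiplicity y (x ∷ a) ≡ multiplicity y (suc k ∷ (x ∸ suc k) ∷ a))
add-part (suc x) k a (s≤s k≤x) with x ∸ k in x∸k
... | zero  = ℕ.≤-refl , λ { _ (suc y) _ → cong (λ z → (if suc z ≡ᵇ suc y then 1 else 0) ℕ.+ multiplicity (suc y) a)
                                                (ℕ.≤-antisym (ℕ.m∸n≡0⇒m≤n x∸k) k≤x) }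
... | suc _ = ℕ.n≤1+n _ , λ eq → ⊥-elim (ℕ.1+n≢n (sym (ℕ.suc-injective eq)))

-- The only monomial of degree k + 1 in p̄₁ (suc k) is a single x_i^(k+1), so a is d with one
-- exponent raised by k + 1.
p̄₁-support : ∀ {a c d} k → Split a c d → p̄₁ (suc k) c ≢ 0ℤ → degree c ≡ suc k →
  nonzeros a ≤ suc (nonzeros d) × (nonzeros a ≡ suc (nonzeros d) → ∀ y → 0 < y → multiplicity y a ≡ multiplicity y (suc k ∷ d))
p̄₁-support k [] ≢0 deg = ⊥-elim (≢0 refl)
p̄₁-support k (_∷_ {x} {a} {c} {d} {zero} _ s) ≢0 deg with p̄₁-support k s (≢0 ∘ trans (p̄₁-0∷ k c)) deg
... | ≤suc , mult = nonzeros-≤ x , mult-≡ x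
  where
  nonzeros-≤ : ∀ x → nonzeros (x ∷ a) ≤ suc (nonzeros (x ∷ d))
  nonzeros-≤ zero    = ≤suc
  nonzeros-≤ (suc x) = s≤s ≤suc
  mult-≡ : ∀ x → nonzeros (x ∷ a) ≡ suc (nonzeros (x ∷ d)) →
           ∀ y → 0 < y → multiplicity y (x ∷ a) ≡ multiplicity y (suc k ∷ x ∷ d)
  mult-≡ zero    eq (suc y) y>0 = mult eq (suc y) y>0
  mult-≡ (suc x) eq y       y>0 =
    trans (cong ((if suc x ≡ᵇ y then 1 else 0) ℕ.+_) (mult (ℕ.suc-injective eq) y y>0))
          (ℕ-+-swapˡ (if suc x ≡ᵇ y then 1 else 0) (if suc k ≡ᵇ y then 1 else 0) (multiplicity y d))
p̄₁-support k (_∷_ {x} {a} {c} {d} {suc j} j<x s) ≢0 deg with degree c ℕ.≟ 0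
... | no deg≢0 = ⊥-elim (≢0 (cong (λ u → (0ℤ + u) * ∏ᵢ (times1+t^ (suc k) δ) c - 0ℤ * ∏ᵢ δ c) (shift-< k δ j j<k)))
  where
  j<k : j < k
  j<k = subst (j <_) (ℕ.suc-injective deg) (ℕ.m<m+n j (ℕ.n≢0⇒n>0 deg≢0))
... | yes deg≡0 with Split-degree≡0 s deg≡0 | trans (sym (ℕ.+-identityʳ j)) (trans (cong (j ℕ.+_) (sym deg≡0)) (ℕ.suc-injective deg))
...   | refl | refl = add-part x j a j<x

+-squeeze : ∀ {p q r t} → p ≤ r → q ≤ t → r ℕ.+ t ≡ p ℕ.+ q → r ≡ p × t ≡ q
+-squeeze {p} {q} {r} {t} p≤r q≤t eq = r≡p , ℕ.+-cancelˡ-≡ p t q (trans (cong (ℕ._+ t) (sym r≡p)) eq)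
  where
  r≡p : r ≡ p
  r≡p = ℕ.≤-antisym (ℕ.+-cancelʳ-≤ t r p (subst (_≤ p ℕ.+ t) (sym eq) (ℕ.+-monoʳ-≤ p q≤t))) p≤r

p̄-support : ∀ μ a → All (0 <_) μ → p̄ μ a ≢ 0ℤ → degree a ≡ degree μ →
  nonzeros a ≤ length μ × (nonzeros a ≡ length μ → ∀ y → 0 < y → multiplicity y a ≡ multiplicity y μ)
p̄-support []          a _         _  deg = subst (_≤ 0) (sym (proj₁ (degree≡0 a deg))) z≤n , λ _ → proj₂ (degree≡0 a deg)
p̄-support (suc k ∷ μ) a (_ ∷ μ>0) ≢0 deg =
  let c , d , s , p̄₁c≢0 , p̄d≢0 = ⊛-≢0 (p̄₁ (suc k)) (p̄ μ) a (≢0 ∘ trans (p̄-∷ (suc k) μ a))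
      deg-c , deg-d = +-squeeze (p̄₁-≢0 (suc k) c p̄₁c≢0) (p̄-≢0 μ d p̄d≢0) (trans (Split-degree s) deg)
      d≤ , d-mult = p̄-support μ d μ>0 p̄d≢0 deg-d
      a≤ , a-mult = p̄₁-support k s p̄₁c≢0 deg-c
  in ℕ.≤-trans a≤ (s≤s d≤) , λ a≡ →
     let d≡ = ℕ.≤-antisym d≤ (ℕ.≤-pred (subst (_≤ suc (nonzeros d)) a≡ a≤))
     in λ y y>0 → trans (a-mult (trans a≡ (cong suc (sym d≡))) y y>0)
                        (cong ((if suc k ≡ᵇ y then 1 else 0) ℕ.+_) (d-mult d≡ y y>0))

≡ᵇ-refl : ∀ x → (x ≡ᵇ x) ≡ true
≡ᵇ-refl zero    = refl
≡ᵇ-refl (suc x) = ≡ᵇ-refl x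

<⇒≡ᵇ-false : ∀ {x y} → x < y → (x ≡ᵇ y) ≡ false
<⇒≡ᵇ-false {zero}  {suc y} _         = refl
<⇒≡ᵇ-false {suc x} {suc y} (s≤s x<y) = <⇒≡ᵇ-false x<y

multiplicity-head : ∀ l xs → multiplicity l (l ∷ xs) ≡ suc (multiplicity l xs)
multiplicity-head l xs = cong (λ b → (if b then 1 else 0) ℕ.+ multiplicity l xs) (≡ᵇ-refl l)

multiplicity-absent : ∀ {y} xs → All (_< y) xs → multiplicity y xs ≡ 0
multiplicity-absent {y} []       []           = refl
multiplicity-absent {y} (x ∷ xs) (x<y ∷ xs<y) =
  cong₂ (λ b m → (if b then 1 else 0) ℕ.+ m) (<⇒≡ᵇ-false x<y) (multiplicity-absent xs xs<y)

Decreasing-head : ∀ {l xs} → Decreasing (l ∷ xs) → All (_≤ l) (l ∷ xs)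
Decreasing-head [ x ]       = ℕ.≤-refl ∷ []
Decreasing-head (y≤x ∷ dec) = ℕ.≤-refl ∷ All.map (λ z≤y → ℕ.≤-trans z≤y y≤x) (Decreasing-head dec)

Decreasing-tail : ∀ {x xs} → Decreasing (x ∷ xs) → Decreasing xs
Decreasing-tail [ x ]     = []
Decreasing-tail (_ ∷ dec) = dec

Decreasing-multiplicity-≡ : ∀ xs ys → Decreasing xs → Decreasing ys → All (0 <_) xs → All (0 <_) ys →
  (∀ y → 0 < y → multiplicity y xs ≡ multiplicity y ys) → xs ≡ ys
Decreasing-multiplicity-≡ []       []       _   _   _ _ _ = refl
Decreasing-multiplicity-≡ []       (m ∷ ys) _   _   _ (m>0 ∷ _) mult = ⊥-elim (ℕ.0≢1+n (trans (mult m m>0) (multiplicity-head m ys)))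
Decreasing-multiplicity-≡ (l ∷ xs) []       _   _   (l>0 ∷ _) _ mult = ⊥-elim (ℕ.0≢1+n (trans (sym (mult l l>0)) (multiplicity-head l xs)))
Decreasing-multiplicity-≡ (l ∷ xs) (m ∷ ys) dx dy (_ ∷ xs>0) (m>0 ∷ ys>0) mult with ℕ.<-cmp l m
... | tri< l<m _ _ = ⊥-elim (ℕ.0≢1+n (begin
  0                            ≡⟨ multiplicity-absent (l ∷ xs) (All.map (λ z≤l → ℕ.≤-<-trans z≤l l<m) (Decreasing-head dx)) ⟨
  multiplicity m (l ∷ xs)      ≡⟨ mult m m>0 ⟩
  multiplicity m (m ∷ ys)      ≡⟨ multiplicity-head m ys ⟩
  suc (multiplicity m ys)      ∎))
... | tri> _ _ m<l = ⊥-elim (ℕ.0≢1+n (begin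
  0                            ≡⟨ multiplicity-absent (m ∷ ys) (All.map (λ z≤m → ℕ.≤-<-trans z≤m m<l) (Decreasing-head dy)) ⟨
  multiplicity l (m ∷ ys)      ≡⟨ mult l (ℕ.≤-<-trans z≤n m<l) ⟨
  multiplicity l (l ∷ xs)      ≡⟨ multiplicity-head l xs ⟩
  suc (multiplicity l xs)      ∎))
... | tri≈ _ refl _ = cong (l ∷_) (Decreasing-multiplicity-≡ xs ys (Decreasing-tail dx) (Decreasing-tail dy) xs>0 ys>0
                                     (λ y y>0 → ℕ.+-cancelˡ-≡ (if l ≡ᵇ y then 1 else 0) _ _ (mult y y>0)))

nonzeros-positive : ∀ xs → All (0 <_) xs → nonzeros xs ≡ length xs
nonzeros-positive []          []          = refl
nonzeros-positive (suc x ∷ xs) (_ ∷ xs>0) = cong suc (nonzeros-positive xs xs>0)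

p̄-offdiagonal : ∀ {μ ν} → IsPartition μ → IsPartition ν → μ ≢ ν → degree μ ≡ degree ν → length μ ≤ length ν →
  p̄ μ ν ≡ 0ℤ
p̄-offdiagonal {μ} {ν} (μ↓ , μ>0) (ν↓ , ν>0) μ≢ν deg len with p̄ μ ν ≟ 0ℤ
... | yes p̄≡0 = p̄≡0
... | no  p̄≢0 =
  let ν≤ , mult = p̄-support μ ν μ>0 p̄≢0 (sym deg)
      ν≡ = trans (nonzeros-positive ν ν>0) (ℕ.≤-antisym (subst (_≤ length μ) (nonzeros-positive ν ν>0) ν≤) len)
  in ⊥-elim (μ≢ν (sym (Decreasing-multiplicity-≡ ν μ ν↓ μ↓ ν>0 μ>0 (mult ν≡))))

_≟ₗ_ : DecidableEquality (List ℕ)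
_≟ₗ_ = ≡-dec ℕ._≟_

count : List ℕ → List (List ℕ) → ℕ
count μ L = length (filter (μ ≟ₗ_) L)

count-++ : ∀ μ xs ys → count μ (xs ++ ys) ≡ count μ xs ℕ.+ count μ ys
count-++ μ xs ys = trans (cong length (filter-++ (μ ≟ₗ_) xs ys)) (length-++ (filter (μ ≟ₗ_) xs))

count-absent : ∀ {μ L} → All (μ ≢_) L → count μ L ≡ 0
count-absent {μ} μ∉L = cong length (filter-none (μ ≟ₗ_) μ∉L)

count-map-∷ : ∀ k ν X → count (k ∷ ν) (map (k ∷_) X) ≡ count ν X
count-map-∷ k ν []      = refl
count-map-∷ k ν (x ∷ X) = by-cases (ν ≟ₗ x)
  where
  by-cases : Dec (ν ≡ x) → count (k ∷ ν) (map (k ∷_) (x ∷ X)) ≡ count ν (x ∷ X)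
  by-cases (yes refl) = trans (cong length (filter-accept ((k ∷ ν) ≟ₗ_) refl))
    (trans (cong suc (count-map-∷ k ν X)) (sym (cong length (filter-accept (ν ≟ₗ_) refl))))
  by-cases (no ν≢x)   = trans (cong length (filter-reject ((k ∷ ν) ≟ₗ_) (ν≢x ∘ ∷-injectiveʳ)))
    (trans (count-map-∷ k ν X) (sym (cong length (filter-reject (ν ≟ₗ_) ν≢x))))

count-map-∷-≢ : ∀ {k l} ν X → k ≢ l → count (l ∷ ν) (map (k ∷_) X) ≡ 0
count-map-∷-≢ ν X k≢l = count-absent (map⁺ (All.universal (λ x eq → k≢l (sym (∷-injectiveˡ eq))) X))

module _ {P : List ℕ → Set} where

  All-concatMap-applyUpTo : ∀ n (f : ℕ → ℕ) (g : ℕ → List (List ℕ)) → (∀ i → i < n → All P (g (f i))) →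
    All P (concatMap g (applyUpTo f n))
  All-concatMap-applyUpTo zero    f g all = []
  All-concatMap-applyUpTo (suc n) f g all =
    ++⁺ (all 0 (s≤s z≤n)) (All-concatMap-applyUpTo n (f ∘ suc) g (λ i i<n → all (suc i) (s≤s i<n)))

count-concatMap-absent : ∀ μ n (f : ℕ → ℕ) (g : ℕ → List (List ℕ)) → (∀ i → i < n → count μ (g (f i)) ≡ 0) →
  count μ (concatMap g (applyUpTo f n)) ≡ 0
count-concatMap-absent μ zero    f g absent = refl
count-concatMap-absent μ (suc n) f g absent = trans (count-++ μ (g (f 0)) _)
  (cong₂ ℕ._+_ (absent 0 (s≤s z≤n)) (count-concatMap-absent μ n (f ∘ suc) g (λ i i<n → absent (suc i) (s≤s i<n))))

count-concatMap-single : ∀ μ n (f : ℕ → ℕ) (g : ℕ → List (List ℕ)) t → t < n →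
  (∀ i → i < n → i ≢ t → count μ (g (f i)) ≡ 0) → count μ (concatMap g (applyUpTo f n)) ≡ count μ (g (f t))
count-concatMap-single μ (suc n) f g zero    _         absent = trans (count-++ μ (g (f 0)) _)
  (trans (cong (count μ (g (f 0)) ℕ.+_) (count-concatMap-absent μ n (f ∘ suc) g (λ i i<n → absent (suc i) (s≤s i<n) λ ())))
         (ℕ.+-identityʳ _))
count-concatMap-single μ (suc n) f g (suc t) (s≤s t<n) absent = trans (count-++ μ (g (f 0)) _)
  (trans (cong (ℕ._+ count μ (concatMap g (applyUpTo (f ∘ suc) n))) (absent 0 (s≤s z≤n) λ ()))
         (count-concatMap-single μ n (f ∘ suc) g t t<n (λ i i<n i≢t → absent (suc i) (s≤s i<n) (i≢t ∘ ℕ.suc-injective))))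

BoundedPartition : ℕ → ℕ → List ℕ → Set
BoundedPartition s m μ = Decreasing μ × All (0 <_) μ × degree μ ≡ s × All (_≤ m) μ

Decreasing-∷ : ∀ {k ν} → All (_≤ k) ν → Decreasing ν → Decreasing (k ∷ ν)
Decreasing-∷ {k} []        []  = [ k ]
Decreasing-∷     (k≥ ∷ _) dec = k≥ ∷ dec

partsWithHead : ℕ → ℕ → ℕ → ℕ → List (List ℕ)
partsWithHead f s m j = if suc j ≤ᵇ m then map (suc j ∷_) (partsBounded f (s ∸ j) (suc j)) else []

partsBounded-sound : ∀ f s m → All (BoundedPartition s m) (partsBounded f s m)
partsBounded-sound f       zero    m = ([] , [] , refl , []) ∷ []
partsBounded-sound zero    (suc s) m = []
partsBounded-sound (suc f) (suc s) m = All-concatMap-applyUpTo (suc s) id (partsWithHead f s m) sound-head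
  where
  sound-head : ∀ i → i < suc s → All (BoundedPartition (suc s) m) (partsWithHead f s m i)
  sound-head i (s≤s i≤s) with suc i ≤ᵇ m in i<m
  ... | false = []
  ... | true  = map⁺ (All.map (λ { (dec , pos , deg , bounded) →
      Decreasing-∷ bounded dec , s≤s z≤n ∷ pos , cong suc (trans (cong (i ℕ.+_) deg) (ℕ.m+[n∸m]≡n i≤s)) ,
      i<m′ ∷ All.map (λ ≤i → ℕ.≤-trans ≤i i<m′) bounded }) (partsBounded-sound f (s ∸ i) (suc i)))
    where
    i<m′ : suc i ≤ m
    i<m′ = ℕ.≤ᵇ⇒≤ (suc i) m (subst T (sym i<m) tt)

partsBounded-count : ∀ f s m μ → BoundedPartition s m μ → s ≤ f → count μ (partsBounded f s m) ≡ 1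
partsBounded-count f       zero    m []          _                       _         = refl
partsBounded-count f       zero    m (x ∷ μ)     (_ , x>0 ∷ _ , deg , _) _         =
  ⊥-elim (ℕ.<⇒≢ (ℕ.<-≤-trans x>0 (ℕ.m≤m+n x (degree μ))) (sym deg))
partsBounded-count (suc f) (suc s) m (zero ∷ ν)  (_ , () ∷ _ , _ , _)    _
partsBounded-count (suc f) (suc s) m (suc j ∷ ν) (dec , _ ∷ ν>0 , deg , j<m ∷ _) (s≤s s≤f) =
  trans (count-concatMap-single (suc j ∷ ν) (suc s) id (partsWithHead f s m) j (s≤s j≤s) others) head-j
  where
  j≤s : j ≤ s
  j≤s = ℕ.≤-trans (ℕ.m≤m+n j (degree ν)) (ℕ.≤-reflexive (ℕ.suc-injective deg))
  others : ∀ i → i < suc s → i ≢ j → count (suc j ∷ ν) (partsWithHead f s m i) ≡ 0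
  others i _ i≢j with suc i ≤ᵇ m
  ... | false = refl
  ... | true  = count-map-∷-≢ ν (partsBounded f (s ∸ i) (suc i)) (i≢j ∘ ℕ.suc-injective)
  head-j : count (suc j ∷ ν) (partsWithHead f s m j) ≡ 1
  head-j with suc j ≤ᵇ m in j<m′
  ... | false = ⊥-elim (subst T j<m′ (ℕ.≤⇒≤ᵇ j<m))
  ... | true  = trans (count-map-∷ (suc j) ν (partsBounded f (s ∸ j) (suc j)))
    (partsBounded-count f (s ∸ j) (suc j) ν
      (Decreasing-tail dec , ν>0 , trans (sym (ℕ.m+n∸m≡n j (degree ν))) (cong (_∸ j) (ℕ.suc-injective deg)) ,
       All.tail (Decreasing-head dec))
      (ℕ.≤-trans (ℕ.m∸n≤m s j) s≤f))

parts≤degree : ∀ μ → All (_≤ degree μ) μ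
parts≤degree []      = []
parts≤degree (x ∷ μ) = ℕ.m≤m+n x (degree μ) ∷ All.map (λ ≤deg → ℕ.≤-trans ≤deg (ℕ.m≤n+m (degree μ) x)) (parts≤degree μ)

partitionsUpTo-sound : ∀ D → All (λ μ → IsPartition μ × degree μ ≤ D) (partitionsUpTo D)
partitionsUpTo-sound D = All-concatMap-applyUpTo (suc D) id partitionsOf (λ i i≤D →
  All.map (λ { (dec , pos , deg , _) → (dec , pos) , subst (_≤ D) (sym deg) (ℕ.≤-pred i≤D) }) (partsBounded-sound i i i))

partitionsUpTo-count : ∀ D μ → IsPartition μ → degree μ ≤ D → count μ (partitionsUpTo D) ≡ 1
partitionsUpTo-count D μ (dec , pos) μ≤D =
  trans (count-concatMap-single μ (suc D) id partitionsOf (degree μ) (s≤s μ≤D) (λ i _ i≢deg →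
           count-absent (All.map (λ { (_ , _ , deg , _) refl → i≢deg (sym deg) }) (partsBounded-sound i i i))))
        (partsBounded-count (degree μ) (degree μ) (degree μ) μ (dec , pos , refl , parts≤degree μ) ℕ.≤-refl)

Combination : Set
Combination = List (ℤ × List ℕ)

⟦_⟧ : Combination → Series
⟦ E ⟧ a = ∑ (λ t → proj₁ t * p̄ (proj₂ t) a) E

AllParts≥ : ℕ → Combination → Set
AllParts≥ k = All (λ t → Decreasing (proj₂ t) × All (k ≤_) (proj₂ t))

appendPart : ℕ → Combination → Combination
appendPart k = map (λ t → proj₁ t , proj₂ t ∷ʳ k)

scale : ℤ → Combination → Combination
scale s = map (λ t → s * proj₁ t , proj₂ t)

⟦⟧-++ : ∀ E F a → ⟦ E ++ F ⟧ a ≡ ⟦ E ⟧ a + ⟦ F ⟧ a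
⟦⟧-++ E F a = ∑-++ _ E F

⟦⟧-scale : ∀ s E a → ⟦ scale s E ⟧ a ≡ s * ⟦ E ⟧ a
⟦⟧-scale s E a = trans (∑-map _ _ E) (trans (∑-cong (λ t → *-assoc s (proj₁ t) _) E) (∑-*ˡ s _ E))

p̄₁-⊛-⟦⟧ : ∀ k E → p̄₁ k ⊛ ⟦ E ⟧ ≗ ⟦ appendPart k E ⟧
p̄₁-⊛-⟦⟧ k E a = trans (⊛-∑ʳ (p̄₁ k) proj₁ (p̄ ∘ proj₂) E a)
  (trans (∑-cong (λ t → cong (_*_ (proj₁ t)) (trans (sym (p̄-∷ k (proj₂ t) a)) (p̄-↭ (∷↭∷ʳ k (proj₂ t)) a))) E)
         (sym (∑-map _ _ E)))

Decreasing-∷ʳ : ∀ {k μ} → Decreasing μ → All (k ≤_) μ → Decreasing (μ ∷ʳ k)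
Decreasing-∷ʳ {k} []          []           = [ k ]
Decreasing-∷ʳ     [ x ]       (k≤x ∷ [])   = k≤x ∷ [ _ ]
Decreasing-∷ʳ     (y≤x ∷ dec) (_ ∷ k≤μ)    = y≤x ∷ Decreasing-∷ʳ dec k≤μ

AllParts≥-appendPart : ∀ {k E} → AllParts≥ k E → AllParts≥ k (appendPart k E)
AllParts≥-appendPart = map⁺ ∘ All.map (λ (dec , k≤μ) → Decreasing-∷ʳ dec k≤μ , ++⁺ k≤μ (ℕ.≤-refl ∷ []))

AllParts≥-scale : ∀ {k E} s → AllParts≥ k E → AllParts≥ k (scale s E)
AllParts≥-scale s = map⁺

AllParts≥-weaken : ∀ {k E} → AllParts≥ (suc k) E → AllParts≥ k E
AllParts≥-weaken {k} = All.map (λ (dec , k<μ) → dec , All.map (ℕ.≤-trans (ℕ.n≤1+n k)) k<μ)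

infix 4 _≈[≤_]_

_≈[≤_]_ : Series → ℕ → Series → Set
F ≈[≤ D ] G = ∀ a → degree a ≤ D → F a ≡ G a

p̄₁-⊛-≈ : ∀ k D {F G} → F ≈[≤ D ] G → p̄₁ k ⊛ F ≈[≤ k ℕ.+ D ] p̄₁ k ⊛ G
p̄₁-⊛-≈ k D {F} {G} F≈G a a≤ = ⊛-cong-Split (p̄₁ k) F G a agree
  where
  agree : ∀ {c d} → Split a c d → p̄₁ k c * F d ≡ p̄₁ k c * G d
  agree {c} {d} s with degree d ℕ.≤? D
  ... | yes d≤D = cong (_*_ (p̄₁ k c)) (F≈G d d≤D)
  ... | no  d≰D = trans (cong (_* F d) p̄₁c≡0) (sym (cong (_* G d) p̄₁c≡0))
    where
    c<k : degree c < k
    c<k = ℕ.+-cancelʳ-< D (degree c) k (ℕ.<-≤-trans (ℕ.+-monoʳ-< (degree c) (ℕ.≰⇒> d≰D))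
            (subst (_≤ k ℕ.+ D) (sym (Split-degree s)) a≤))
    p̄₁c≡0 : p̄₁ k c ≡ 0ℤ
    p̄₁c≡0 = p̄₁-low k c c<k

-- Factorising ∏ᵢ h into powers of 1 + p̄ₖ

-- divide k h is h / (1 + t^(suc k)); with fuel n its coefficients below n are exact.
divideWithFuel : ℕ → ℕ → (ℕ → ℤ) → ℕ → ℤ
divideWithFuel zero    k h x = h x
divideWithFuel (suc n) k h x = h x - shift (suc k) (divideWithFuel n k h) x

divide : ℕ → (ℕ → ℤ) → ℕ → ℤ
divide k h x = divideWithFuel (suc x) k h x

shift-≤-local : ∀ k (F G : ℕ → ℤ) y → (∀ z → z ≤ y → F z ≡ G z) → shift k F y ≡ shift k G y
shift-≤-local zero    F G y       F≡G = F≡G y ℕ.≤-refl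
shift-≤-local (suc k) F G zero    F≡G = refl
shift-≤-local (suc k) F G (suc y) F≡G = shift-≤-local k F G y (λ z z≤y → F≡G z (ℕ.m≤n⇒m≤1+n z≤y))

shift-<-local : ∀ k (F G : ℕ → ℤ) y → (∀ z → z < y → F z ≡ G z) → shift (suc k) F y ≡ shift (suc k) G y
shift-<-local k F G zero    F≡G = refl
shift-<-local k F G (suc y) F≡G = shift-≤-local k F G y (λ z z≤y → F≡G z (s≤s z≤y))

divideWithFuel-enough : ∀ k h n m y → y < n → y < m → divideWithFuel n k h y ≡ divideWithFuel m k h y
divideWithFuel-enough k h (suc n) (suc m) y y<n y<m = cong (_-_ (h y)) (shift-<-local k _ _ y (λ z z<y →
  divideWithFuel-enough k h n m z (ℕ.<-≤-trans z<y (ℕ.≤-pred y<n)) (ℕ.<-≤-trans z<y (ℕ.≤-pred y<m))))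

times1+t^-divide : ∀ k h → times1+t^ (suc k) (divide k h) ≗ h
times1+t^-divide k h x = trans
  (cong (_+_ (divide k h x)) (shift-<-local k (divide k h) (divideWithFuel x k h) x
    (λ z z<x → divideWithFuel-enough k h (suc z) x z ℕ.≤-refl z<x)))
  (cancel (h x) (shift (suc k) (divideWithFuel x k h) x))
  where
  cancel : ∀ a b → a - b + b ≡ a
  cancel = solve-∀

divide-low : ∀ k h j → j ≤ k → divide k h j ≡ h j
divide-low k h j j≤k = trans (cong (_-_ (h j)) (shift-< (suc k) _ j (s≤s j≤k))) (+-identityʳ (h j))

divide-at : ∀ k h → h 0 ≡ 1ℤ → divide k h (suc k) ≡ h (suc k) - 1ℤ
divide-at k h h0≡1 = cong (_-_ (h (suc k))) (trans (shift-self (suc k) _) (trans (+-identityʳ (h 0)) h0≡1))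

times1+t^-low : ∀ k (h : ℕ → ℤ) j → j ≤ k → times1+t^ (suc k) h j ≡ h j
times1+t^-low k h j j≤k = trans (cong (_+_ (h j)) (shift-< (suc k) h j (s≤s j≤k))) (+-identityʳ (h j))

times1+t^-at : ∀ k h → h 0 ≡ 1ℤ → times1+t^ (suc k) h (suc k) ≡ h (suc k) + 1ℤ
times1+t^-at k h h0≡1 = cong (_+_ (h (suc k))) (trans (shift-self (suc k) h) h0≡1)

∏ᵢ-≈ : ∀ D {h g : ℕ → ℤ} → (∀ x → x ≤ D → h x ≡ g x) → ∏ᵢ h ≈[≤ D ] ∏ᵢ g
∏ᵢ-≈ D h≡g []      _   = refl
∏ᵢ-≈ D h≡g (x ∷ a) a≤D = cong₂ _*_ (h≡g x (ℕ.≤-trans (ℕ.m≤m+n x (degree a)) a≤D))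
                                    (∏ᵢ-≈ D h≡g a (ℕ.≤-trans (ℕ.m≤n+m (degree a) x) a≤D))

p̄-[] : p̄ [] ≗ ∏ᵢ δ
p̄-[] a = trans (p̄-∑ [] a) (trans (+-identityʳ _) (*-identityˡ _))

TrivialUpTo : ℕ → (ℕ → ℤ) → Set
TrivialUpTo k h = ∀ j → j ≤ k → h j ≡ δ j

TrivialUpTo-suc : ∀ {k h} → TrivialUpTo k h → h (suc k) ≡ 0ℤ → TrivialUpTo (suc k) h
TrivialUpTo-suc {k} triv hk≡0 j j≤ with j ℕ.≤? k
... | yes j≤k = triv j j≤k
... | no  j≰k with ℕ.≤-antisym j≤ (ℕ.≰⇒> j≰k)
...   | refl = hk≡0

Expansion : ℕ → ℕ → Series → Set
Expansion D k F = ∃[ E ] (AllParts≥ k E × F ≈[≤ D ] ⟦ E ⟧)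

Expansion-≈ : ∀ {D k F G} → F ≈[≤ D ] G → Expansion D k G → Expansion D k F
Expansion-≈ F≈G (E , parts , G≈E) = E , parts , λ a a≤D → trans (F≈G a a≤D) (G≈E a a≤D)

Expansion-+ : ∀ {D k F G} → Expansion D k F → Expansion D k G → Expansion D k (λ a → F a + G a)
Expansion-+ (E₁ , parts₁ , F≈) (E₂ , parts₂ , G≈) =
  E₁ ++ E₂ , ++⁺ parts₁ parts₂ , λ a a≤D → trans (cong₂ _+_ (F≈ a a≤D) (G≈ a a≤D)) (sym (⟦⟧-++ E₁ E₂ a))

Expansion-scale : ∀ {D k F} s → Expansion D k F → Expansion D k (λ a → s * F a)
Expansion-scale s (E , parts , F≈) =
  scale s E , AllParts≥-scale s parts , λ a a≤D → trans (cong (_*_ s) (F≈ a a≤D)) (sym (⟦⟧-scale s E a))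

Expansion-∑ : ∀ {D k} (c : A → ℤ) (F : A → Series) xs → (∀ x → Expansion D k (F x)) →
  Expansion D k (λ a → ∑ (λ x → c x * F x a) xs)
Expansion-∑ c F []       _   = [] , [] , λ _ _ → refl
Expansion-∑ c F (x ∷ xs) exp = Expansion-+ (Expansion-scale (c x) (exp x)) (Expansion-∑ c F xs exp)

Expansion-weaken : ∀ {D k F} → Expansion D (suc k) F → Expansion D k F
Expansion-weaken (E , parts , F≈) = E , AllParts≥-weaken parts , F≈

ExpansionsAt : ℕ → ℕ → Set
ExpansionsAt D k = ∀ h → TrivialUpTo k h → Expansion D (suc k) (∏ᵢ h)

expansions-low : ∀ D k → D ≤ k → ExpansionsAt D k
expansions-low D k D≤k h triv = ((1ℤ , []) ∷ []) , (([] , []) ∷ []) , λ a a≤D →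
  trans (∏ᵢ-≈ D (λ x x≤D → triv x (ℕ.≤-trans x≤D D≤k)) a a≤D) (sym (trans (+-identityʳ _) (trans (*-identityˡ _) (p̄-[] a))))

-- Writing h = (1 + t^(k+1)) q when h (k + 1) > 0, or g = (1 + t^(k+1)) h when h (k + 1) < 0, moves
-- the coefficient at k + 1 one step towards 0, and ∏ᵢ ((1 + t^(k+1)) f) − ∏ᵢ f = p̄₁ (k + 1) ⊛ ∏ᵢ f
-- is only needed up to degree D − (k + 1).
module _ {D k} (higher : ExpansionsAt D (suc k)) (lower : ExpansionsAt (D ∸ suc k) k) where

  private
    K : ℕ
    K = suc k

  Expansion-p̄₁-⊛ : ∀ f → TrivialUpTo k f → Expansion D K (λ a → ∏ᵢ (times1+t^ K f) a - ∏ᵢ f a)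
  Expansion-p̄₁-⊛ f triv = let E , parts , f≈ = lower f triv in
    appendPart K E , AllParts≥-appendPart parts , λ a a≤D → begin
      ∏ᵢ (times1+t^ K f) a - ∏ᵢ f a ≡⟨ p̄₁-⊛-∏ᵢ K f a ⟨
      (p̄₁ K ⊛ ∏ᵢ f) a              ≡⟨ p̄₁-⊛-≈ K (D ∸ K) f≈ a (ℕ.≤-trans a≤D (ℕ.m≤n+m∸n D K)) ⟩
      (p̄₁ K ⊛ ⟦ E ⟧) a             ≡⟨ p̄₁-⊛-⟦⟧ K E a ⟩
      ⟦ appendPart K E ⟧ a          ∎

  expansion-nonneg : ∀ m h → TrivialUpTo k h → h K ≡ + m → Expansion D K (∏ᵢ h)
  expansion-nonneg zero    h triv hK≡0 = Expansion-weaken (higher h (TrivialUpTo-suc triv hK≡0))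
  expansion-nonneg (suc m) h triv hK≡ =
    Expansion-≈ (λ a _ → trans (∏ᵢ-cong (sym ∘ times1+t^-divide k h) a) (sym (add-sub (∏ᵢ (times1+t^ K q) a) (∏ᵢ q a))))
      (Expansion-+ (expansion-nonneg m q q-triv qK≡) (Expansion-p̄₁-⊛ q q-triv))
    where
    q : ℕ → ℤ
    q = divide k h
    q-triv : TrivialUpTo k q
    q-triv j j≤k = trans (divide-low k h j j≤k) (triv j j≤k)
    qK≡ : q K ≡ + m
    qK≡ = trans (divide-at k h (triv 0 z≤n)) (cong (_- 1ℤ) hK≡)
    add-sub : ∀ x y → y + (x - y) ≡ x
    add-sub = solve-∀

  expansion-neg : ∀ m h → TrivialUpTo k h → h K ≡ -[1+ m ] → Expansion D K (∏ᵢ h)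
  expansion-neg m h triv hK≡ =
    Expansion-≈ (λ a _ → sym (sub-sub (∏ᵢ g a) (∏ᵢ h a))) (Expansion-+ (expansion-g m gK≡) (Expansion-scale -1ℤ (Expansion-p̄₁-⊛ h triv)))
    where
    g : ℕ → ℤ
    g = times1+t^ K h
    g-triv : TrivialUpTo k g
    g-triv j j≤k = trans (times1+t^-low k h j j≤k) (triv j j≤k)
    gK≡ : g K ≡ -[1+ m ] + 1ℤ
    gK≡ = trans (times1+t^-at k h (triv 0 z≤n)) (cong (_+ 1ℤ) hK≡)
    expansion-g : ∀ m → g K ≡ -[1+ m ] + 1ℤ → Expansion D K (∏ᵢ g)
    expansion-g zero    gK≡0 = expansion-nonneg 0 g g-triv gK≡0
    expansion-g (suc m) gK≡  = expansion-neg m g g-triv gK≡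
    sub-sub : ∀ x y → x + -1ℤ * (x - y) ≡ y
    sub-sub = solve-∀

  expansions-step : ExpansionsAt D k
  expansions-step h triv with h K in hK≡
  ... | + m      = expansion-nonneg m h triv hK≡
  ... | -[1+ m ] = expansion-neg m h triv hK≡

expansions-from : ∀ D → (∀ k → ExpansionsAt (D ∸ suc k) k) → ∀ n k → D ≤ n ℕ.+ k → ExpansionsAt D k
expansions-from D lower zero    k D≤k = expansions-low D k D≤k
expansions-from D lower (suc n) k D≤  =
  expansions-step (expansions-from D lower n (suc k) (subst (D ≤_) (sym (ℕ.+-suc n k)) D≤)) (lower k)

expansions : ∀ D k → ExpansionsAt D k
expansions = <-rec (λ D → ∀ k → ExpansionsAt D k) λ where
  zero    _       k → expansions-low 0 k z≤n
  (suc D) smaller k → expansions-from (suc D) (λ k′ → smaller (s≤s (ℕ.m∸n≤m D k′)) k′) (suc D) k (ℕ.m≤m+n (suc D) k)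

∏ᵢ-expansion : ∀ D h → h 0 ≡ 1ℤ → Expansion D 1 (∏ᵢ h)
∏ᵢ-expansion D h h0≡1 = expansions D 0 h λ { zero z≤n → h0≡1 }

∑-allSubsets-single : ∀ n (F : Vec Bool n → ℤ) → (∀ S → S ≢ Vec.replicate n false → F S ≡ 0ℤ) →
  ∑ F (allSubsets n) ≡ F (Vec.replicate n false)
∑-allSubsets-single zero    F _   = +-identityʳ (F [])
∑-allSubsets-single (suc n) F F≡0 = trans (∑-allSubsets-suc n F)
  (trans (∑-cong (λ S → trans (cong (_+ F (false ∷ S)) (F≡0 (true ∷ S) λ ())) (+-identityˡ _)) (allSubsets n))
         (∑-allSubsets-single n (F ∘ (false ∷_)) (λ S S≢ → F≡0 (false ∷ S) (S≢ ∘ Vec-∷-injectiveʳ))))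

≢replicate-false : ∀ {n} (S : Vec Bool n) → S ≢ Vec.replicate n false → ∃[ v ] Vec.lookup S v ≡ true
≢replicate-false []          S≢ = ⊥-elim (S≢ refl)
≢replicate-false (true  ∷ S) S≢ = zero , refl
≢replicate-false (false ∷ S) S≢ = let v , Sv = ≢replicate-false S (S≢ ∘ cong (false ∷_)) in suc v , Sv

sumFin-≥ : ∀ n (g : Fin n → ℕ) v → g v ≤ sumFin g
sumFin-≥ (suc n) g zero    = subst (g zero ≤_) (sym (sumFin-suc n g)) (ℕ.m≤m+n (g zero) _)
sumFin-≥ (suc n) g (suc v) = subst (g (suc v) ≤_) (sym (sumFin-suc n g))
  (ℕ.≤-trans (sumFin-≥ n (g ∘ suc) v) (ℕ.m≤n+m _ (g zero)))

sumFin-zero : ∀ n → sumFin {n} (λ _ → 0) ≡ 0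
sumFin-zero zero    = refl
sumFin-zero (suc n) = trans (sumFin-suc n (λ _ → 0)) (sumFin-zero n)

independentCount-zero : ∀ {n} (G : Graph n) ω → (∀ v → 0 < ω v) → ∀ U → independentCount G ω U 0 ≡ 1ℤ
independentCount-zero {n} G ω ω>0 U = trans (∑-allSubsets-single n _ nonempty≡0)
  (trans (independentOfWeight-cong G ω U 0 (λ v → lookup-replicate v false)) empty≡1)
  where
  nonempty≡0 : ∀ S → S ≢ Vec.replicate n false → independentOfWeight G ω U 0 (Vec.lookup S) ≡ 0ℤ
  nonempty≡0 S S≢∅ with weight ω (Vec.lookup S) in wt≡ | ≢replicate-false S S≢∅
  ... | zero  | v , Sv≡true = ⊥-elim (ℕ.<⇒≢ (ℕ.<-≤-trans (subst (λ b → 0 < (if b then ω v else 0)) (sym Sv≡true) (ω>0 v))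
                                                         (sumFin-≥ n _ v)) (sym wt≡))
  ... | suc _ | _           = trans (cong (_*_ (avoids U (Vec.lookup S))) (*-zeroʳ (independent G (Vec.lookup S))))
                                     (*-zeroʳ (avoids U (Vec.lookup S)))
  if-1 : ∀ b → (if b then 1ℤ else 1ℤ) ≡ 1ℤ
  if-1 true  = refl
  if-1 false = refl
  empty≡1 : independentOfWeight G ω U 0 (λ _ → false) ≡ 1ℤ
  empty≡1 = cong₂ _*_ (trans (∏-cong (if-1 ∘ Vec.lookup U)) (∏-one n))
    (cong₂ _*_ (trans (∏-cong (λ u → trans (∏-cong (λ v → cong 𝟙 (∨-zeroʳ (not (adj G u v))))) (∏-one n))) (∏-one n))
               (cong (λ w → 𝟙 (w ≡ᵇ 0)) (sumFin-zero n)))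

kromatic-expansion : ∀ {n} (G : Graph n) ω → (∀ v → 0 < ω v) → ∀ D → Expansion D 1 (λ a → + kromaticCoeff G ω a)
kromatic-expansion {n} G ω ω>0 D = Expansion-≈ (λ a _ → kromaticCoeff-∑ G ω a)
  (Expansion-∑ sign (∏ᵢ ∘ independentCount G ω) (allSubsets n)
               (λ U → ∏ᵢ-expansion D (independentCount G ω U) (independentCount-zero G ω ω>0 U)))

select : List ℕ → ℤ → List ℕ → ℤ
select μ z ν = if does (μ ≟ₗ ν) then z else 0ℤ

coefficient : Combination → List ℕ → ℤ
coefficient E ν = ∑ (λ t → select (proj₂ t) (proj₁ t) ν) E

∑-select : ∀ μ z a L → ∑ (λ ν → select μ z ν * p̄ ν a) L ≡ + count μ L * (z * p̄ μ a)
∑-select μ z a []      = sym (*-zeroˡ (z * p̄ μ a))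
∑-select μ z a (ν ∷ L) = by-cases ν (μ ≟ₗ ν)
  where
  by-cases : ∀ ν (μ≟ν : Dec (μ ≡ ν)) →
    (if does μ≟ν then z else 0ℤ) * p̄ ν a + ∑ (λ ν → select μ z ν * p̄ ν a) L ≡ + count μ (ν ∷ L) * (z * p̄ μ a)
  by-cases ν (yes refl) = begin
    z * p̄ μ a + ∑ (λ ν → select μ z ν * p̄ ν a) L ≡⟨ cong (_+_ (z * p̄ μ a)) (∑-select μ z a L) ⟩
    z * p̄ μ a + + count μ L * (z * p̄ μ a)         ≡⟨ cong (_+ + count μ L * (z * p̄ μ a)) (*-identityˡ (z * p̄ μ a)) ⟨
    1ℤ * (z * p̄ μ a) + + count μ L * (z * p̄ μ a)  ≡⟨ *-distribʳ-+ (z * p̄ μ a) 1ℤ (+ count μ L) ⟨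
    + suc (count μ L) * (z * p̄ μ a)               ≡⟨ cong (λ L′ → + length L′ * (z * p̄ μ a)) (filter-accept (μ ≟ₗ_) refl) ⟨
    + count μ (μ ∷ L) * (z * p̄ μ a)               ∎
  by-cases ν (no μ≢ν) = trans (+-identityˡ _) (trans (∑-select μ z a L)
    (cong (λ L′ → + length L′ * (z * p̄ μ a)) (sym (filter-reject (μ ≟ₗ_) μ≢ν))))

∑-coefficient : ∀ E → AllParts≥ 1 E → ∀ a → ∑ (λ ν → coefficient E ν * p̄ ν a) (partitionsUpTo (degree a)) ≡ ⟦ E ⟧ a
∑-coefficient E parts a = begin
  ∑ (λ ν → coefficient E ν * p̄ ν a) L
    ≡⟨ ∑-cong (λ ν → sym (∑-*ʳ (p̄ ν a) _ E)) L ⟩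
  ∑ (λ ν → ∑ (λ t → select (proj₂ t) (proj₁ t) ν * p̄ ν a) E) L
    ≡⟨ ∑-comm _ L E ⟩
  ∑ (λ t → ∑ (λ ν → select (proj₂ t) (proj₁ t) ν * p̄ ν a) L) E
    ≡⟨ ∑-cong-All parts (λ {t} μ-partition → trans (∑-select (proj₂ t) (proj₁ t) a L) (counted-once {z = proj₁ t} μ-partition)) ⟩
  ⟦ E ⟧ a ∎
  where
  L : List (List ℕ)
  L = partitionsUpTo (degree a)
  counted-once : ∀ {μ z} → IsPartition μ → + count μ L * (z * p̄ μ a) ≡ z * p̄ μ a
  counted-once {μ} {z} μ-partition with degree μ ℕ.≤? degree a | p̄ μ a ≟ 0ℤ
  ... | yes μ≤a | _        = trans (cong (λ n → + n * (z * p̄ μ a)) (partitionsUpTo-count (degree a) μ μ-partition μ≤a))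
                                   (*-identityˡ _)
  ... | no  _   | yes p̄≡0 = subst (λ p → + count μ L * (z * p) ≡ z * p) (sym p̄≡0)
    (trans (cong (_*_ (+ count μ L)) (*-zeroʳ z)) (trans (*-zeroʳ (+ count μ L)) (sym (*-zeroʳ z))))
  ... | no  μ≰a | no p̄≢0  = ⊥-elim (μ≰a (p̄-≢0 μ a p̄≢0))

kromatic-coefficients : ∀ {n} (G : Graph n) ω → (∀ v → 0 < ω v) → ∀ D →
  ∃[ e ] (∀ a → degree a ≤ D → ∑ (λ ν → e ν * p̄ ν a) (partitionsUpTo (degree a)) ≡ + kromaticCoeff G ω a)
kromatic-coefficients G ω ω>0 D = let E , parts , X≈E = kromatic-expansion G ω ω>0 D in
  coefficient E , λ a a≤D → trans (∑-coefficient E parts a) (sym (X≈E a a≤D))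

-- Uniqueness of rational expansions

ι : ℤ → ℚ
ι z = z / 1

toℚᵘ-ι : ∀ z → toℚᵘ (ι z) ℚᵘ.≃ mkℚᵘ z 0
toℚᵘ-ι z = ℚ.toℚᵘ-fromℚᵘ (mkℚᵘ z 0)

ι-+ : ∀ x y → ι (x + y) ≡ ι x ℚ.+ ι y
ι-+ x y = ℚ.toℚᵘ-injective (ℚᵘ.≃-trans (toℚᵘ-ι (x + y)) (ℚᵘ.≃-sym (ℚᵘ.≃-trans (ℚ.toℚᵘ-homo-+ (ι x) (ι y))
  (ℚᵘ.≃-trans (ℚᵘ.+-cong (toℚᵘ-ι x) (toℚᵘ-ι y)) (ℚᵘ.*≡* (cross-multiply x y))))))
  where
  cross-multiply : ∀ x y → (x * 1ℤ + y * 1ℤ) * 1ℤ ≡ (x + y) * 1ℤ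
  cross-multiply = solve-∀

ι-* : ∀ x y → ι (x * y) ≡ ι x ℚ.* ι y
ι-* x y = ℚ.toℚᵘ-injective (ℚᵘ.≃-trans (toℚᵘ-ι (x * y)) (ℚᵘ.≃-sym (ℚᵘ.≃-trans (ℚ.toℚᵘ-homo-* (ι x) (ι y))
  (ℚᵘ.≃-trans (ℚᵘ.*-cong (toℚᵘ-ι x) (toℚᵘ-ι y)) (ℚᵘ.*≡* refl)))))

sumℚ-ι : (f : A → ℤ) → ∀ xs → sumℚ (map (ι ∘ f) xs) ≡ ι (∑ f xs)
sumℚ-ι f []       = refl
sumℚ-ι f (x ∷ xs) = trans (cong (ι (f x) ℚ.+_) (sumℚ-ι f xs)) (sym (ι-+ (f x) (∑ f xs)))

sumℚ-cong-All : ∀ {P : A → Set} {f g : A → ℚ} {xs} → All P xs → (∀ {x} → P x → f x ≡ g x) → sumℚ (map f xs) ≡ sumℚ (map g xs)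
sumℚ-cong-All []         f≡g = refl
sumℚ-cong-All (px ∷ pxs) f≡g = cong₂ ℚ._+_ (f≡g px) (sumℚ-cong-All pxs f≡g)

open ℚ-Solver

sumℚ-distrib-- : (f g : A → ℚ) → ∀ xs → sumℚ (map (λ x → f x ℚ.- g x) xs) ≡ sumℚ (map f xs) ℚ.- sumℚ (map g xs)
sumℚ-distrib-- f g []       = refl
sumℚ-distrib-- f g (x ∷ xs) = trans (cong (f x ℚ.- g x ℚ.+_) (sumℚ-distrib-- f g xs))
  (solve 4 (λ a b c d → (a :- b) :+ (c :- d) := (a :+ c) :- (b :+ d)) refl (f x) (g x) (sumℚ (map f xs)) (sumℚ (map g xs)))

sumℚ-absent : ∀ {P : List ℕ → Set} (f : List ℕ → ℚ) ν L → count ν L ≡ 0 → All P L →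
  (∀ {μ} → P μ → μ ≢ ν → f μ ≡ 0ℚ) → sumℚ (map f L) ≡ 0ℚ
sumℚ-absent f ν []      _     []         _      = refl
sumℚ-absent f ν (μ ∷ L) count≡0 (pμ ∷ pL) f≡0 = by-cases (ν ≟ₗ μ)
  where
  by-cases : Dec (ν ≡ μ) → f μ ℚ.+ sumℚ (map f L) ≡ 0ℚ
  by-cases (yes ν≡μ) = ⊥-elim (ℕ.1+n≢0 (trans (cong length (sym (filter-accept (ν ≟ₗ_) ν≡μ))) count≡0))
  by-cases (no  ν≢μ) = cong₂ ℚ._+_ (f≡0 pμ (ν≢μ ∘ sym))
    (sumℚ-absent f ν L (trans (cong length (sym (filter-reject (ν ≟ₗ_) ν≢μ))) count≡0) pL f≡0)

sumℚ-single : ∀ {P : List ℕ → Set} (f : List ℕ → ℚ) ν L → count ν L ≡ 1 → All P L →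
  (∀ {μ} → P μ → μ ≢ ν → f μ ≡ 0ℚ) → sumℚ (map f L) ≡ f ν
sumℚ-single f ν []      ()      []
sumℚ-single f ν (μ ∷ L) count≡1 (pμ ∷ pL) f≡0 = by-cases (ν ≟ₗ μ)
  where
  by-cases : Dec (ν ≡ μ) → f μ ℚ.+ sumℚ (map f L) ≡ f ν
  by-cases (yes refl) = trans (cong (f ν ℚ.+_) (sumℚ-absent f ν L
    (ℕ.suc-injective (trans (cong length (sym (filter-accept (ν ≟ₗ_) refl))) count≡1)) pL f≡0)) (ℚ.+-identityʳ (f ν))
  by-cases (no  ν≢μ)  = trans (cong₂ ℚ._+_ (f≡0 pμ (ν≢μ ∘ sym))
    (sumℚ-single f ν L (trans (cong length (sym (filter-reject (ν ≟ₗ_) ν≢μ))) count≡1) pL f≡0)) (ℚ.+-identityˡ _)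

*-ι-suc-cancel : ∀ q n → q ℚ.* ι (+ suc n) ≡ 0ℚ → q ≡ 0ℚ
*-ι-suc-cancel q n q*n≡0 = begin
  q                          ≡⟨ ℚ.*-identityʳ q ⟨
  q ℚ.* 1ℚ                   ≡⟨ cong (q ℚ.*_) (ℚ.*-inverseʳ m) ⟨
  q ℚ.* (m ℚ.* ℚ.1/ m)       ≡⟨ ℚ.*-assoc q m (ℚ.1/ m) ⟨
  q ℚ.* m ℚ.* ℚ.1/ m         ≡⟨ cong (ℚ._* ℚ.1/ m) q*n≡0 ⟩
  0ℚ ℚ.* ℚ.1/ m              ≡⟨ ℚ.*-zeroˡ (ℚ.1/ m) ⟩
  0ℚ                         ∎
  where
  m : ℚ
  m = ι (+ suc n)
  instance
    m-nonZero : ℚ.NonZero m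
    m-nonZero = ℚ.pos⇒nonZero m {{ℚ.normalize-pos (suc n) 1}}

p̄-combination : (List ℕ → ℚ) → Monomial → ℚ
p̄-combination c a = sumℚ (map (λ μ → c μ ℚ.* ι (p̄ μ a)) (partitionsUpTo (degree a)))

p̄-combination-ι : ∀ e a → p̄-combination (ι ∘ e) a ≡ ι (∑ (λ μ → e μ * p̄ μ a) (partitionsUpTo (degree a)))
p̄-combination-ι e a = trans (cong sumℚ (map-cong (λ μ → sym (ι-* (e μ) (p̄ μ a))) (partitionsUpTo (degree a))))
                            (sumℚ-ι (λ μ → e μ * p̄ μ a) (partitionsUpTo (degree a)))

p̄-combination-distrib-- : ∀ c c′ a → p̄-combination (λ μ → c μ ℚ.- c′ μ) a ≡ p̄-combination c a ℚ.- p̄-combination c′ a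
p̄-combination-distrib-- c c′ a =
  trans (cong sumℚ (map-cong (λ μ → distrib (c μ) (c′ μ) (ι (p̄ μ a))) (partitionsUpTo (degree a))))
        (sumℚ-distrib-- (λ μ → c μ ℚ.* ι (p̄ μ a)) (λ μ → c′ μ ℚ.* ι (p̄ μ a)) (partitionsUpTo (degree a)))
  where
  distrib : ∀ x y p → (x ℚ.- y) ℚ.* p ≡ x ℚ.* p ℚ.- y ℚ.* p
  distrib = solve 3 (λ x y p → (x :- y) :* p := x :* p :- y :* p) refl

p̄-diagonal-suc : ∀ μ → All (0 <_) μ → ∃[ m ] p̄ μ μ ≡ + suc m
p̄-diagonal-suc μ μ>0 with pbarCoeff μ μ | p̄-diagonal μ μ>0
... | zero  | +≤+ ()
... | suc m | _      = m , refl

length≤degree : ∀ xs → All (0 <_) xs → length xs ≤ degree xs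
length≤degree []       []          = z≤n
length≤degree (x ∷ xs) (x>0 ∷ xs>0) = ℕ.+-mono-≤ x>0 (length≤degree xs xs>0)

_⊏_ : List ℕ → List ℕ → Set
_⊏_ = ×-Lex _≡_ _<_ _<_ on λ μ → degree μ , degree μ ∸ length μ

⊏-wellFounded : WellFounded _⊏_
⊏-wellFounded = On.wellFounded _ (×-wellFounded <-wellFounded <-wellFounded)

p̄-combination-kernel : ∀ D d → (∀ a → degree a ≤ D → p̄-combination d a ≡ 0ℚ) →
  ∀ ν → IsPartition ν → degree ν ≤ D → d ν ≡ 0ℚ
p̄-combination-kernel D d kernel = WF.All.wfRec ⊏-wellFounded _ _ step
  where
  step : ∀ ν → (∀ {μ} → μ ⊏ ν → IsPartition μ → degree μ ≤ D → d μ ≡ 0ℚ) → IsPartition ν → degree ν ≤ D → d ν ≡ 0ℚ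
  step ν smaller ν-partition ν≤D = let m , p̄νν≡ = p̄-diagonal-suc ν (proj₂ ν-partition) in
    *-ι-suc-cancel (d ν) m (begin
      d ν ℚ.* ι (+ suc m)  ≡⟨ cong (λ z → d ν ℚ.* ι z) p̄νν≡ ⟨
      d ν ℚ.* ι (p̄ ν ν)    ≡⟨ sumℚ-single (λ μ → d μ ℚ.* ι (p̄ μ ν)) ν (partitionsUpTo (degree ν))
                                (partitionsUpTo-count (degree ν) ν ν-partition ℕ.≤-refl) (partitionsUpTo-sound (degree ν)) vanish ⟨
      p̄-combination d ν    ≡⟨ kernel ν ν≤D ⟩
      0ℚ                   ∎)
    where
    smaller-vanish : ∀ {μ} → IsPartition μ → degree μ ≤ degree ν → μ ⊏ ν → d μ ℚ.* ι (p̄ μ ν) ≡ 0ℚ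
    smaller-vanish {μ} μ-partition μ≤ν μ⊏ν =
      trans (cong (ℚ._* ι (p̄ μ ν)) (smaller μ⊏ν μ-partition (ℕ.≤-trans μ≤ν ν≤D))) (ℚ.*-zeroˡ (ι (p̄ μ ν)))
    vanish : ∀ {μ} → IsPartition μ × degree μ ≤ degree ν → μ ≢ ν → d μ ℚ.* ι (p̄ μ ν) ≡ 0ℚ
    vanish {μ} (μ-partition , μ≤ν) μ≢ν = by-degree (ℕ.m≤n⇒m<n∨m≡n μ≤ν)
      where
      by-length : degree μ ≡ degree ν → Dec (length ν < length μ) → d μ ℚ.* ι (p̄ μ ν) ≡ 0ℚ
      by-length μ≡ν (yes ν<μ) = smaller-vanish μ-partition μ≤ν (inj₂ (μ≡ν , subst (λ s → s ∸ length μ < degree ν ∸ length ν)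
        (sym μ≡ν) (ℕ.∸-monoʳ-< ν<μ (subst (length μ ≤_) μ≡ν (length≤degree μ (proj₂ μ-partition))))))
      by-length μ≡ν (no  ν≮μ) = trans (cong (λ z → d μ ℚ.* ι z) (p̄-offdiagonal μ-partition ν-partition μ≢ν μ≡ν (ℕ.≮⇒≥ ν≮μ)))
                                      (ℚ.*-zeroʳ (d μ))
      by-degree : degree μ < degree ν ⊎ degree μ ≡ degree ν → d μ ℚ.* ι (p̄ μ ν) ≡ 0ℚ
      by-degree (inj₁ μ<ν) = smaller-vanish μ-partition μ≤ν (inj₁ μ<ν)
      by-degree (inj₂ μ≡ν) = by-length μ≡ν (length ν ℕ.<? length μ)

p̄-combination-unique : ∀ D {c c′} → (∀ a → degree a ≤ D → p̄-combination c a ≡ p̄-combination c′ a) →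
  ∀ ν → IsPartition ν → degree ν ≤ D → c ν ≡ c′ ν
p̄-combination-unique D {c} {c′} same ν ν-partition ν≤D =
  difference≡0 (c ν) (c′ ν) (p̄-combination-kernel D (λ μ → c μ ℚ.- c′ μ) kernel ν ν-partition ν≤D)
  where
  kernel : ∀ a → degree a ≤ D → p̄-combination (λ μ → c μ ℚ.- c′ μ) a ≡ 0ℚ
  kernel a a≤D = trans (p̄-combination-distrib-- c c′ a)
    (trans (cong (ℚ._- p̄-combination c′ a) (same a a≤D)) (ℚ.+-inverseʳ (p̄-combination c′ a)))
  difference≡0 : ∀ x y → x ℚ.- y ≡ 0ℚ → x ≡ y
  difference≡0 x y x-y≡0 = trans (solve 2 (λ x y → x := (x :- y) :+ y) refl x y)
                                  (trans (cong (ℚ._+ y) x-y≡0) (ℚ.+-identityˡ y))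

corollary1p5 : ∀ {n} (G : Graph n) (ω : Fin n → ℕ) → (∀ v → 0 < ω v)
    → (∃[ c ] IsPbarExpansion G ω c)
      × (∀ (c : List ℕ → ℚ) → IsPbarExpansion G ω c
           → ∀ (λ' : List ℕ) → IsPartition λ' → IsInteger (c λ'))
corollary1p5 G ω ω>0 = (c⋆ , c⋆-expansion) , integral
  where
  e : ℕ → List ℕ → ℤ
  e D = proj₁ (kromatic-coefficients G ω ω>0 D)
  e-expansion : ∀ D a → degree a ≤ D → p̄-combination (ι ∘ e D) a ≡ ℕ→ℚ (kromaticCoeff G ω a)
  e-expansion D a a≤D = trans (p̄-combination-ι (e D) a) (cong ι (proj₂ (kromatic-coefficients G ω ω>0 D) a a≤D))
  c⋆ : List ℕ → ℚ
  c⋆ ν = ι (e (degree ν) ν)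
  e≡c⋆ : ∀ D ν → IsPartition ν → degree ν ≤ D → ι (e D ν) ≡ c⋆ ν
  e≡c⋆ D ν ν-partition ν≤D = p̄-combination-unique (degree ν) {ι ∘ e D} {ι ∘ e (degree ν)}
    (λ a a≤ν → trans (e-expansion D a (ℕ.≤-trans a≤ν ν≤D)) (sym (e-expansion (degree ν) a a≤ν))) ν ν-partition ℕ.≤-refl
  c⋆-expansion : IsPbarExpansion G ω c⋆
  c⋆-expansion a = trans (sumℚ-cong-All (partitionsUpTo-sound (degree a))
    (λ { {μ} (μ-partition , μ≤a) → cong (ℚ._* ι (p̄ μ a)) (sym (e≡c⋆ (degree a) μ μ-partition μ≤a)) }))
    (e-expansion (degree a) a ℕ.≤-refl)
  integral : ∀ c → IsPbarExpansion G ω c → ∀ ν → IsPartition ν → IsInteger (c ν)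
  integral c c-expansion ν ν-partition = e (degree ν) ν ,
    p̄-combination-unique (degree ν) {c} {c⋆} (λ a _ → trans (c-expansion a) (sym (c⋆-expansion a))) ν ν-partition ℕ.≤-refl
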